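{- Let $X,Y$ be finite posets, for each $x\in X$ let $Y_x\subseteq Y$ be totally ordered, let $\Psi$ be a set of pairs $(x_1,x_2)$ in $X$ with $x_1<x_2$, and let $T$ be the set of tableaux $f:X\to Y$ with $f(x)\in Y_x$ for all $x$, $f(x_1)\le f(x_2)$ whenever $x_1\le x_2$, and $f(x_1)<f(x_2)$ whenever $(x_1,x_2)\in\Psi$. Set $E=\bigcup_{f\in T}f$ and $\Delta=\Delta(X,Y,T,E)$. For $f\in T$ and $x\in X$ let $U_f(x)$ be the set of $y\in Y$ with $f(x)<y$ such that changing the value of $f$ at $x$ from $f(x)$ to $y$ yields a tableau in $T$. Then \[K(S/I_\Delta;\mathbf t)=\sum_{f\in T}\prod_{x\in X}\Bigg(\big(1-t_{v_{(x,f(x))}}\big)\prod_{y\in U_f(x)}t_{v_{(x,y)}}\Bigg).\] Moreover, for each $j$, the entry $h_j$ of the $h$-vector of $S/I_\Delta$ equals the number of tableaux $f\in T$ with $\sum_{x\in X}|U_f(x)|=j$.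
   Context: A tableau is a function $f:X\to Y$ identified with its graph in $X\times Y$. Put $v_{(x,y)}:=E\setminus\{(x,y)\}$ for $(x,y)\in E$ and $V=\{v_{(x,y)}:(x,y)\in E\}$. The tableau complex $\Delta(X,Y,T,E)$ is the simplicial complex on ground set $V$ whose faces are the sets $\{v_{(x,y)}:(x,y)\in E\setminus F\}$ for $F\subseteq E$ containing some $f\in T$. Let $\mathbb{k}$ be a field, $S=\mathbb{k}[V]$, and $I_\Delta$ the Stanley–Reisner ideal, generated by $\prod_{v\in G}v$ for non-faces $G\subseteq V$. With the $\mathbb Z^V$-grading (variable $v$ of degree $t_v$), $K(S/I_\Delta;\mathbf t)$ is the numerator of the Hilbert series of $S/I_\Delta$ over $\prod_{v\in V}(1-t_v)$. The $h$-vector $(h_0,\dots,h_d)$ is defined by writing the $\mathbb Z$-graded Hilbert series (all $t_v\mapsto t$) as $\sum_j h_jt^j/(1-t)^d$, $d$ the Krull dimension of $S/I_\Delta$. -}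

module Defs where

open import Level using (0ℓ)
open import Data.Nat as ℕ using (ℕ; zero; suc; _≤_; _∸_)
open import Data.Nat.Combinatorics using (_C_)
open import Data.Integer as ℤ using (ℤ)
open import Data.Fin using (Fin; _≟_)
open import Data.Fin.Properties using (all?)
open import Data.Fin.Subset using (Subset; _∈_; _∉_; ∣_∣)
open import Data.Vec using (Vec; []; _∷_; lookup; _[_]≔_)
open import Data.List as List using (List; []; _∷_; _++_; map; filter; length; allFin; concatMap; foldr; upTo)
open import Data.Product using (Σ; _×_; _,_; ∃; ∃-syntax)
open import Data.Sum using (_⊎_)
open import Relation.Binary using (Rel)
open import Relation.Binary.Structures using (IsDecPartialOrder)
open import Relation.Binary.PropositionalEquality using (_≡_; _≢_)
open import Relation.Nullary using (Dec; ¬_; yes; no)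
open import Relation.Nullary.Decidable using (_×-dec_; _→-dec_; ¬?; ⌊_⌋)
open import Data.Bool using (if_then_else_; _∧_)

-- Y_x ⊆ Y (as a finite subset), totally ordered by the order of Y.
-- Ψ is given as  Ψ : Fin n → Subset n, with  x₂ ∈ Ψ x₁  meaning (x₁,x₂) ∈ Ψ.

record TableauData : Set₁ where
  field
    n m       : ℕ
    _≤X_      : Rel (Fin n) 0ℓ
    isPosetX  : IsDecPartialOrder {A = Fin n} _≡_ _≤X_
    _≤Y_      : Rel (Fin m) 0ℓ
    isPosetY  : IsDecPartialOrder {A = Fin m} _≡_ _≤Y_
    Yx        : Fin n → Subset m
    Yx-total  : ∀ x {y y′} → y ∈ Yx x → y′ ∈ Yx x → (y ≤Y y′) ⊎ (y′ ≤Y y)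
    Ψ         : Fin n → Subset n
    Ψ-strict  : ∀ {x₁ x₂} → x₂ ∈ Ψ x₁ → (x₁ ≤X x₂) × (x₁ ≢ x₂)

allVecs : ∀ {A : Set} → List A → (k : ℕ) → List (Vec A k)
allVecs xs zero    = [] ∷ []
allVecs xs (suc k) = concatMap (λ x → map (x ∷_) (allVecs xs k)) xs

sumℕ : List ℕ → ℕ
sumℕ = foldr ℕ._+_ 0

sumℤ : List ℤ → ℤ
sumℤ = foldr ℤ._+_ (ℤ.+ 0)

-- Multivariate polynomials over ℤ in the variables t_{(x,y)}, (x,y) ∈ X × Y,
-- represented as formal sums of terms (coefficient, exponent vector).

Exp : ℕ → ℕ → Set
Exp n m = Fin n → Fin m → ℕ

Poly : ℕ → ℕ → Set
Poly n m = List (ℤ × Exp n m)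

module _ {n m : ℕ} where

  pone : Poly n m
  pone = (ℤ.+ 1 , λ _ _ → 0) ∷ []

  pvar : Fin n → Fin m → Poly n m
  pvar x y = (ℤ.+ 1 , λ x′ y′ → if ⌊ x ≟ x′ ⌋ ∧ ⌊ y ≟ y′ ⌋ then 1 else 0) ∷ []

  padd : Poly n m → Poly n m → Poly n m
  padd = _++_

  pneg : Poly n m → Poly n m
  pneg = map (λ { (c , e) → (ℤ.- c , e) })

  psub : Poly n m → Poly n m → Poly n m
  psub p q = padd p (pneg q)

  pmul : Poly n m → Poly n m → Poly n m
  pmul p q = concatMap (λ { (c , e) → map (λ { (c′ , e′) → (c ℤ.* c′ , λ x y → e x y ℕ.+ e′ x y) }) q }) p

  psum : List (Poly n m) → Poly n m
  psum = foldr padd []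

  pprod : List (Poly n m) → Poly n m
  pprod = foldr pmul pone

  _≤ₑ?_ : (e a : Exp n m) → Dec (∀ x y → e x y ≤ a x y)
  e ≤ₑ? a = all? (λ x → all? (λ y → e x y ℕ.≤? a x y))

  -- coefficient of t^a in  p / ∏_v (1 - t_v)  (= ∑_{b ≤ a} coeff_b p)
  seriesCoeff : Poly n m → Exp n m → ℤ
  seriesCoeff p a = sumℤ (map (λ { (c , e) → if ⌊ e ≤ₑ? a ⌋ then c else ℤ.+ 0 }) p)

  degree : Exp n m → ℕ
  degree a = sumℕ (map (λ x → sumℕ (map (a x) (allFin m))) (allFin n))

  expsOfDegree : ℕ → List (Exp n m)
  expsOfDegree N =
    filter (λ a → degree a ℕ.≟ N)
      (map (λ v x y → lookup (lookup v x) y) (allVecs (allVecs (upTo (suc N)) m) n))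

module Tableaux (D : TableauData) where
  open TableauData D

  _<Y_ : Rel (Fin m) 0ℓ
  y <Y y′ = (y ≤Y y′) × (y ≢ y′)

  Tableau : Set
  Tableau = Vec (Fin m) n

  InT : Tableau → Set
  InT f = (∀ x → lookup f x ∈ Yx x)
        × (∀ x₁ x₂ → x₁ ≤X x₂ → lookup f x₁ ≤Y lookup f x₂)
        × (∀ x₁ x₂ → x₂ ∈ Ψ x₁ → lookup f x₁ <Y lookup f x₂)

  InT? : ∀ f → Dec (InT f)
  InT? f =
    all? (λ x → lookup f x Data.Fin.Subset.Properties.∈? Yx x)
    ×-dec all? (λ x₁ → all? (λ x₂ →
            IsDecPartialOrder._≤?_ isPosetX x₁ x₂ →-dec IsDecPartialOrder._≤?_ isPosetY (lookup f x₁) (lookup f x₂)))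
    ×-dec all? (λ x₁ → all? (λ x₂ →
            (x₂ Data.Fin.Subset.Properties.∈? Ψ x₁) →-dec
              (IsDecPartialOrder._≤?_ isPosetY (lookup f x₁) (lookup f x₂) ×-dec ¬? (lookup f x₁ ≟ lookup f x₂))))
    where import Data.Fin.Subset.Properties

  Tlist : List Tableau
  Tlist = filter InT? (allVecs (allFin m) n)

  InE : Fin n → Fin m → Set
  InE x y = Σ Tableau λ f → (InT f × lookup f x ≡ y)

  InU : Tableau → Fin n → Fin m → Set
  InU f x y = (lookup f x <Y y) × InT (f [ x ]≔ y)

  InU? : ∀ f x y → Dec (InU f x y)
  InU? f x y = (IsDecPartialOrder._≤?_ isPosetY (lookup f x) y ×-dec ¬? (lookup f x ≟ y)) ×-dec InT? (f [ x ]≔ y)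

  Ulist : Tableau → Fin n → List (Fin m)
  Ulist f x = filter (InU? f x) (allFin m)

  ∣U∣ : Tableau → Fin n → ℕ
  ∣U∣ f x = length (Ulist f x)

  -- Subsets of V = {v_e : e ∈ E} are encoded by the corresponding subsets of
  -- E ⊆ X × Y  (v_e ↦ e is a bijection V ≅ E); G x is the fibre over x.
  SubsetXY : Set
  SubsetXY = Fin n → Subset m

  ∣_∣ₛ : SubsetXY → ℕ
  ∣ G ∣ₛ = sumℕ (map (λ x → ∣ G x ∣) (allFin n))

  -- faces of Δ(X,Y,T,E): {v_e : e ∈ E ∖ F} for F ⊆ E containing some f ∈ T
  IsFace : SubsetXY → Set
  IsFace G = Σ SubsetXY λ F → ( (∀ x y → y ∈ F x → InE x y)
                    × (∃[ f ] (InT f × (∀ x → lookup f x ∈ F x)))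
                    × (∀ x y → (y ∈ G x → InE x y × y ∉ F x)
                             × (InE x y × y ∉ F x → y ∈ G x)) )

  -- the monomial t^a (a supported on V) lies in I_Δ, the ideal generated by
  -- the monomials ∏_{v ∈ G} v over non-faces G ⊆ V
  InI : Exp n m → Set
  InI a = Σ SubsetXY λ G → ( (∀ x y → y ∈ G x → InE x y)
                 × ¬ IsFace G
                 × (∀ x y → y ∈ G x → 1 ≤ a x y) )

  SupportedOnE : Exp n m → Set
  SupportedOnE a = ∀ x y → ¬ InE x y → a x y ≡ 0

  -- H is the ℤ^V-graded Hilbert function of S/I_Δ:
  -- H a = dim_k (S/I_Δ)_a, which is 0 if t^a ∈ I_Δ and 1 otherwise (S_a is
  -- spanned by the monomial t^a and I_Δ is a monomial ideal);
  -- exponents not supported on V are given the value 0.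
  IsHilbertFunction : (Exp n m → ℕ) → Set
  IsHilbertFunction H = ∀ a → (¬ SupportedOnE a → H a ≡ 0)
                            × (SupportedOnE a → InI a → H a ≡ 0)
                            × (SupportedOnE a → ¬ InI a → H a ≡ 1)

  hilbZ : (Exp n m → ℕ) → ℕ → ℕ
  hilbZ H N = sumℕ (map H (expsOfDegree N))

  -- Krull dimension of S/I_Δ  (= dim Δ + 1 = maximal cardinality of a face)
  IsKrullDim : ℕ → Set
  IsKrullDim d = (Σ SubsetXY λ G → (IsFace G × ∣ G ∣ₛ ≡ d)) × (∀ G → IsFace G → ∣ G ∣ₛ ≤ d)

  -- number of monomials of degree k in d variables: coefficient of t^k in 1/(1-t)^d
  monomials : ℕ → ℕ → ℕ
  monomials d k = (k ℕ.+ d ∸ 1) C k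

  -- h is the h-vector of S/I_Δ (w.r.t. Krull dimension d):
  -- HS(S/I_Δ; t) = ∑_j h_j t^j / (1-t)^d, compared coefficientwise.
  IsHVector : (Exp n m → ℕ) → ℕ → (ℕ → ℕ) → Set
  IsHVector H d h = ∀ N → hilbZ H N ≡ sumℕ (map (λ j → h j ℕ.* monomials d (N ∸ j)) (upTo (suc N)))

  Kformula : Poly n m
  Kformula = psum (map (λ f → pprod (map (λ x →
               pmul (psub pone (pvar x (lookup f x))) (pprod (map (pvar x) (Ulist f x))))
               (allFin n))) Tlist)

  countT : ℕ → ℕ
  countT j = length (filter (λ f → sumℕ (map (∣U∣ f) (allFin n)) ℕ.≟ j) Tlist)

  Theorem4p5 : Set
  Theorem4p5 =
    ∀ (H : Exp n m → ℕ) → IsHilbertFunction H →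
      -- K(S/I_Δ; t) = Kformula, i.e.  HS(S/I_Δ; t) = Kformula / ∏_{v∈V}(1 - t_v)
      (∀ a → SupportedOnE a → ℤ.+ (H a) ≡ seriesCoeff Kformula a)
    × (∀ d → IsKrullDim d → IsHVector H d countT)

{-# OPTIONS --safe #-}
-- A monomial t^a with support in E survives in S/I_Δ iff its support is a
-- face, i.e. iff some f ∈ T avoids it. As every Y_x is totally ordered, the
-- tableaux avoiding supp a are closed under pointwise maximum, so there is a
-- greatest one, and it is the only f ∈ T that is good for a: a vanishes on
-- the graph of f and is positive on (x, y) for every y ∈ U_f(x). Hence the
-- Hilbert function is H(a) = Σ_{f ∈ T} [a is good for f], which is the
-- Stanley decomposition S/I_Δ = ⊕_f t^{U_f} k[v_e : e ∈ E ∖ graph f]. The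
-- coefficient of t^a in the f-th summand of the formula divided by
-- ∏_v (1 - t_v) is exactly [a is good for f], which gives the K-polynomial;
-- counting the monomials of degree N in each Stanley summand, in
-- |E ∖ graph f| = dim S/I_Δ variables and divisible by a monomial of degree
-- Σ_x |U_f(x)|, gives the h-vector.
module Submission where

import Data.Integer as ℤ
open import Data.List using (upTo)
import Data.Nat as ℕ
open import Data.Product using (_,_)
open import Relation.Binary.PropositionalEquality
open import Defs

module FiniteSums where

  open import Data.Bool using (true; false; if_then_else_)
  open import Data.Empty using (⊥-elim)
  open import Data.Fin using (Fin; zero; suc)
  open import Data.Fin.Properties using (all?) renaming (suc-injective to Fin-suc-injective)
  open import Data.List
    using (List; []; _∷_; _++_; map; filter; length; allFin; concatMap; upTo; applyUpTo; tabulate)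
  open import Data.List.Membership.Propositional using (_∈_)
  open import Data.List.Properties using (map-tabulate)
  import Data.List.Relation.Unary.All as All
  open import Data.List.Relation.Unary.Any using (here; there)
  open import Data.Nat using (ℕ; zero; suc; _+_; _*_; _≤_; _<_; _≤?_; _<?_; z≤n; s≤s)
  open import Data.Nat.ListAction using (product)
  open import Data.Nat.Properties
    using (+-assoc; +-identityʳ; *-zeroʳ; *-distribˡ-+; +-mono-≤; suc-injective; ≤-pred; +-commutativeSemigroup)
  open import Algebra.Properties.CommutativeSemigroup +-commutativeSemigroup using (interchange)
  open import Data.Product using (_×_; _,_)
  open import Data.Vec using (Vec; []; _∷_)
  open import Data.Vec.Properties using (∷-injectiveˡ; ∷-injectiveʳ)
  open import Function using (_∘_; _⇔_; mk⇔)
  open import Relation.Binary.PropositionalEquality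
  open import Relation.Nullary using (Dec; yes; no; ¬_; does)
  open import Relation.Nullary.Decidable using (_×-dec_; does-⇔)
  open import Relation.Unary using (Pred; Decidable)

  private variable
    A B : Set

  𝟙 : ∀ {p} {P : Set p} → Dec P → ℕ
  𝟙 d = if does d then 1 else 0

  module _ {p} {P : Set p} where

    if-yes : ∀ {a} {A : Set a} (d : Dec P) {x y : A} → P → (if does d then x else y) ≡ x
    if-yes (yes _) _ = refl
    if-yes (no ¬p) p = ⊥-elim (¬p p)

    if-no : ∀ {a} {A : Set a} (d : Dec P) {x y : A} → ¬ P → (if does d then x else y) ≡ y
    if-no (yes p) ¬p = ⊥-elim (¬p p)
    if-no (no _) _ = refl

    𝟙-yes : (d : Dec P) → P → 𝟙 d ≡ 1
    𝟙-yes d = if-yes d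

    𝟙-no : (d : Dec P) → ¬ P → 𝟙 d ≡ 0
    𝟙-no d = if-no d

    𝟙-⇔ : ∀ {q} {Q : Set q} → P ⇔ Q → (d : Dec P) (e : Dec Q) → 𝟙 d ≡ 𝟙 e
    𝟙-⇔ P⇔Q d e = cong (λ b → if b then 1 else 0) (does-⇔ P⇔Q d e)

  𝟙-× : ∀ {p q} {P : Set p} {Q : Set q} (d : Dec P) (e : Dec Q) → 𝟙 d * 𝟙 e ≡ 𝟙 (d ×-dec e)
  𝟙-× (yes _) (yes _) = refl
  𝟙-× (yes _) (no _) = refl
  𝟙-× (no _) _ = refl

  ∑ : List A → (A → ℕ) → ℕ
  ∑ xs g = sumℕ (map g xs)

  infix 5 ∑
  syntax ∑ xs (λ x → e) = ∑[ x ∈ xs ] e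

  ∑-cong : ∀ {g h : A → ℕ} xs → (∀ x → g x ≡ h x) → ∑ xs g ≡ ∑ xs h
  ∑-cong [] _ = refl
  ∑-cong (x ∷ xs) g≗h = cong₂ _+_ (g≗h x) (∑-cong xs g≗h)

  ∑-zero : ∀ {g : A → ℕ} xs → (∀ x → g x ≡ 0) → ∑ xs g ≡ 0
  ∑-zero [] _ = refl
  ∑-zero (x ∷ xs) g≗0 = cong₂ _+_ (g≗0 x) (∑-zero xs g≗0)

  ∑-++ : ∀ (g : A → ℕ) xs ys → ∑ (xs ++ ys) g ≡ ∑ xs g + ∑ ys g
  ∑-++ g [] ys = refl
  ∑-++ g (x ∷ xs) ys = trans (cong (g x +_) (∑-++ g xs ys)) (sym (+-assoc (g x) _ _))

  ∑-map : ∀ (g : B → ℕ) (f : A → B) xs → ∑ (map f xs) g ≡ ∑ xs (g ∘ f)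
  ∑-map g f [] = refl
  ∑-map g f (x ∷ xs) = cong (g (f x) +_) (∑-map g f xs)

  ∑-concatMap : ∀ (g : B → ℕ) (h : A → List B) xs → ∑ (concatMap h xs) g ≡ ∑[ x ∈ xs ] ∑ (h x) g
  ∑-concatMap g h [] = refl
  ∑-concatMap g h (x ∷ xs) =
    trans (∑-++ g (h x) (concatMap h xs)) (cong (∑ (h x) g +_) (∑-concatMap g h xs))

  ∑-*ˡ : ∀ k (g : A → ℕ) xs → ∑[ x ∈ xs ] k * g x ≡ k * ∑ xs g
  ∑-*ˡ k g [] = sym (*-zeroʳ k)
  ∑-*ˡ k g (x ∷ xs) = trans (cong (k * g x +_) (∑-*ˡ k g xs)) (sym (*-distribˡ-+ k (g x) _))

  ∑-+ : ∀ (g h : A → ℕ) xs → ∑[ x ∈ xs ] (g x + h x) ≡ ∑ xs g + ∑ xs h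
  ∑-+ g h [] = refl
  ∑-+ g h (x ∷ xs) = trans (cong (g x + h x +_) (∑-+ g h xs)) (interchange (g x) (h x) _ _)

  ∑-comm : ∀ (g : A → B → ℕ) xs ys → ∑[ x ∈ xs ] ∑ ys (g x) ≡ ∑[ y ∈ ys ] ∑[ x ∈ xs ] g x y
  ∑-comm g [] ys = sym (∑-zero ys (λ _ → refl))
  ∑-comm g (x ∷ xs) ys = trans (cong (∑ ys (g x) +_) (∑-comm g xs ys)) (sym (∑-+ (g x) _ ys))

  ∑-filter : ∀ {p} {P : Pred A p} (P? : Decidable P) (g : A → ℕ) xs →
             ∑ (filter P? xs) g ≡ ∑[ x ∈ xs ] 𝟙 (P? x) * g x
  ∑-filter P? g [] = refl
  ∑-filter P? g (x ∷ xs) with does (P? x)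
  ... | true = cong₂ _+_ (sym (+-identityʳ (g x))) (∑-filter P? g xs)
  ... | false = ∑-filter P? g xs

  length-filter : ∀ {p} {P : Pred A p} (P? : Decidable P) xs →
                  length (filter P? xs) ≡ ∑[ x ∈ xs ] 𝟙 (P? x)
  length-filter P? [] = refl
  length-filter P? (x ∷ xs) with does (P? x)
  ... | true = cong suc (length-filter P? xs)
  ... | false = length-filter P? xs

  ∑ᶠ ∏ᶠ : ∀ {k} → (Fin k → ℕ) → ℕ
  ∑ᶠ {zero} g = 0
  ∑ᶠ {suc k} g = g zero + ∑ᶠ (g ∘ suc)
  ∏ᶠ {zero} g = 1
  ∏ᶠ {suc k} g = g zero * ∏ᶠ (g ∘ suc)

  ∑ᶠ-cong : ∀ {k} {g h : Fin k → ℕ} → (∀ i → g i ≡ h i) → ∑ᶠ g ≡ ∑ᶠ h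
  ∑ᶠ-cong {zero} _ = refl
  ∑ᶠ-cong {suc k} g≗h = cong₂ _+_ (g≗h zero) (∑ᶠ-cong (g≗h ∘ suc))

  ∏ᶠ-cong : ∀ {k} {g h : Fin k → ℕ} → (∀ i → g i ≡ h i) → ∏ᶠ g ≡ ∏ᶠ h
  ∏ᶠ-cong {zero} _ = refl
  ∏ᶠ-cong {suc k} g≗h = cong₂ _*_ (g≗h zero) (∏ᶠ-cong (g≗h ∘ suc))

  ∑ᶠ-zero : ∀ {k} {g : Fin k → ℕ} → (∀ i → g i ≡ 0) → ∑ᶠ g ≡ 0
  ∑ᶠ-zero {zero} _ = refl
  ∑ᶠ-zero {suc k} g≗0 = cong₂ _+_ (g≗0 zero) (∑ᶠ-zero (g≗0 ∘ suc))

  ∑ᶠ-+ : ∀ {k} (g h : Fin k → ℕ) → ∑ᶠ (λ i → g i + h i) ≡ ∑ᶠ g + ∑ᶠ h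
  ∑ᶠ-+ {zero} g h = refl
  ∑ᶠ-+ {suc k} g h =
    trans (cong (g zero + h zero +_) (∑ᶠ-+ (g ∘ suc) (h ∘ suc))) (interchange (g zero) (h zero) _ _)

  ∑ᶠ-mono : ∀ {k} {g h : Fin k → ℕ} → (∀ i → g i ≤ h i) → ∑ᶠ g ≤ ∑ᶠ h
  ∑ᶠ-mono {zero} _ = z≤n
  ∑ᶠ-mono {suc k} g≤h = +-mono-≤ (g≤h zero) (∑ᶠ-mono (g≤h ∘ suc))

  ∑ᶠ-point : ∀ {k} (g : Fin k → ℕ) c → (∀ i → i ≢ c → g i ≡ 0) → ∑ᶠ g ≡ g c
  ∑ᶠ-point g zero g≗0 = trans (cong (g zero +_) (∑ᶠ-zero (λ i → g≗0 (suc i) λ ()))) (+-identityʳ _)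
  ∑ᶠ-point g (suc c) g≗0 =
    trans (cong (_+ ∑ᶠ (g ∘ suc)) (g≗0 zero λ ()))
          (∑ᶠ-point (g ∘ suc) c (λ i i≢c → g≗0 (suc i) (i≢c ∘ Fin-suc-injective)))

  ∏ᶠ-𝟙 : ∀ {k p} {P : Pred (Fin k) p} (P? : Decidable P) → ∏ᶠ (𝟙 ∘ P?) ≡ 𝟙 (all? P?)
  ∏ᶠ-𝟙 {zero} P? = refl
  ∏ᶠ-𝟙 {suc k} {P = P} P? = begin
    𝟙 (P? zero) * ∏ᶠ (𝟙 ∘ P?′)  ≡⟨ cong (𝟙 (P? zero) *_) (∏ᶠ-𝟙 P?′) ⟩
    𝟙 (P? zero) * 𝟙 (all? P?′)  ≡⟨ 𝟙-× (P? zero) (all? P?′) ⟩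
    𝟙 (P? zero ×-dec all? P?′)  ≡⟨ 𝟙-⇔ (mk⇔ cons uncons) (P? zero ×-dec all? P?′) (all? P?) ⟩
    𝟙 (all? P?)                 ∎
    where
    open ≡-Reasoning
    P?′ : Decidable (λ i → P (suc i))
    P?′ i = P? (suc i)
    cons : P zero × (∀ i → P (suc i)) → ∀ i → P i
    cons (p , _) zero = p
    cons (_ , ps) (suc i) = ps i
    uncons : (∀ i → P i) → P zero × (∀ i → P (suc i))
    uncons ps = ps zero , λ i → ps (suc i)

  ∑-allFin : ∀ {k} (g : Fin k → ℕ) → ∑ (allFin k) g ≡ ∑ᶠ g
  ∑-allFin {k} g = trans (cong sumℕ (map-tabulate (λ i → i) g)) (go g)
    where
    go : ∀ {k} (g : Fin k → ℕ) → sumℕ (tabulate g) ≡ ∑ᶠ g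
    go {zero} g = refl
    go {suc k} g = cong (g zero +_) (go (g ∘ suc))

  ∑-allVecs-point : ∀ {m} k (g : Vec (Fin m) k → ℕ) c → (∀ v → v ≢ c → g v ≡ 0) →
                    ∑ (allVecs (allFin m) k) g ≡ g c
  ∑-allVecs-point zero g [] _ = +-identityʳ _
  ∑-allVecs-point {m} (suc k) g (c ∷ cs) g≗0 = begin
    ∑ (concatMap (λ y → map (y ∷_) vecs) (allFin m)) g  ≡⟨ ∑-concatMap g _ (allFin m) ⟩
    ∑[ y ∈ allFin m ] ∑ (map (y ∷_) vecs) g             ≡⟨ ∑-cong (allFin m) (λ y → ∑-map g (y ∷_) vecs) ⟩
    ∑[ y ∈ allFin m ] ∑[ v ∈ vecs ] g (y ∷ v)           ≡⟨ ∑-allFin (λ y → ∑[ v ∈ vecs ] g (y ∷ v)) ⟩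
    ∑ᶠ (λ y → ∑[ v ∈ vecs ] g (y ∷ v))                  ≡⟨ ∑ᶠ-point _ c off-head ⟩
    ∑[ v ∈ vecs ] g (c ∷ v)                             ≡⟨ ∑-allVecs-point k (g ∘ (c ∷_)) cs off-tail ⟩
    g (c ∷ cs)                                          ∎
    where
    open ≡-Reasoning
    vecs : List (Vec (Fin m) k)
    vecs = allVecs (allFin m) k
    off-head : ∀ y → y ≢ c → ∑[ v ∈ vecs ] g (y ∷ v) ≡ 0
    off-head y y≢c = ∑-zero vecs (λ v → g≗0 (y ∷ v) (y≢c ∘ ∷-injectiveˡ))
    off-tail : ∀ v → v ≢ cs → g (c ∷ v) ≡ 0
    off-tail v v≢cs = g≗0 (c ∷ v) (v≢cs ∘ ∷-injectiveʳ)

  ∑ᵣ : ℕ → (ℕ → ℕ) → ℕ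
  ∑ᵣ zero g = 0
  ∑ᵣ (suc K) g = g 0 + ∑ᵣ K (g ∘ suc)

  ∑-upTo : ∀ K (g : ℕ → ℕ) → ∑ (upTo K) g ≡ ∑ᵣ K g
  ∑-upTo K g = go K (λ i → i)
    where
    go : ∀ K (f : ℕ → ℕ) → ∑ (applyUpTo f K) g ≡ ∑ᵣ K (g ∘ f)
    go zero f = refl
    go (suc K) f = cong (g (f 0) +_) (go K (f ∘ suc))

  ∑ᵣ-cong : ∀ K {g h : ℕ → ℕ} → (∀ i → i < K → g i ≡ h i) → ∑ᵣ K g ≡ ∑ᵣ K h
  ∑ᵣ-cong zero _ = refl
  ∑ᵣ-cong (suc K) g≗h = cong₂ _+_ (g≗h 0 (s≤s z≤n)) (∑ᵣ-cong K λ i i<K → g≗h (suc i) (s≤s i<K))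

  ∑ᵣ-zero : ∀ K {g : ℕ → ℕ} → (∀ i → g i ≡ 0) → ∑ᵣ K g ≡ 0
  ∑ᵣ-zero zero _ = refl
  ∑ᵣ-zero (suc K) g≗0 = cong₂ _+_ (g≗0 0) (∑ᵣ-zero K (g≗0 ∘ suc))

  ∑ᵣ-truncate : ∀ K e (g : ℕ → ℕ) → (∀ i → K ≤ i → g i ≡ 0) → ∑ᵣ (K + e) g ≡ ∑ᵣ K g
  ∑ᵣ-truncate zero e g g≗0 = ∑ᵣ-zero e (λ i → g≗0 i z≤n)
  ∑ᵣ-truncate (suc K) e g g≗0 = cong (g 0 +_) (∑ᵣ-truncate K e (g ∘ suc) λ i K≤i → g≗0 (suc i) (s≤s K≤i))

  ∑ᵣ-point : ∀ K (g : ℕ → ℕ) c → (∀ i → i ≢ c → g i ≡ 0) → ∑ᵣ K g ≡ (if does (c <? K) then g c else 0)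
  ∑ᵣ-point zero g c _ = refl
  ∑ᵣ-point (suc K) g zero g≗0 = trans (cong (g 0 +_) (∑ᵣ-zero K (λ i → g≗0 (suc i) λ ()))) (+-identityʳ _)
  ∑ᵣ-point (suc K) g (suc c) g≗0 = begin
    g 0 + ∑ᵣ K (g ∘ suc)                              ≡⟨ cong (_+ ∑ᵣ K (g ∘ suc)) (g≗0 0 λ ()) ⟩
    ∑ᵣ K (g ∘ suc)                                    ≡⟨ ∑ᵣ-point K (g ∘ suc) c off-c ⟩
    (if does (c <? K) then g (suc c) else 0)          ≡⟨ cong (λ b → if b then g (suc c) else 0) c<K⇔ ⟩
    (if does (suc c <? suc K) then g (suc c) else 0)  ∎
    where
    open ≡-Reasoning
    off-c : ∀ i → i ≢ c → g (suc i) ≡ 0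
    off-c i i≢c = g≗0 (suc i) (i≢c ∘ suc-injective)
    c<K⇔ : does (c <? K) ≡ does (suc c <? suc K)
    c<K⇔ = does-⇔ (mk⇔ s≤s ≤-pred) (c <? K) (suc c <? suc K)

  ∑-upTo-point : ∀ N (g : ℕ → ℕ) c → (∀ i → i ≢ c → g i ≡ 0) →
                 ∑ (upTo (suc N)) g ≡ (if does (c ≤? N) then g c else 0)
  ∑-upTo-point N g c g≗0 = begin
    ∑ (upTo (suc N)) g                         ≡⟨ ∑-upTo (suc N) g ⟩
    ∑ᵣ (suc N) g                               ≡⟨ ∑ᵣ-point (suc N) g c g≗0 ⟩
    (if does (c <? suc N) then g c else 0)     ≡⟨ cong (λ b → if b then g c else 0) c<N+1⇔c≤N ⟩
    (if does (c ≤? N) then g c else 0)         ∎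
    where
    open ≡-Reasoning
    c<N+1⇔c≤N : does (c <? suc N) ≡ does (c ≤? N)
    c<N+1⇔c≤N = does-⇔ (mk⇔ ≤-pred s≤s) (c <? suc N) (c ≤? N)

  product-𝟙 : ∀ {p} {P : Pred A p} (P? : Decidable P) xs →
              product (map (𝟙 ∘ P?) xs) ≡ 𝟙 (All.all? P? xs)
  product-𝟙 P? [] = refl
  product-𝟙 P? (x ∷ xs) = trans (cong (𝟙 (P? x) *_) (product-𝟙 P? xs)) (𝟙-× (P? x) (All.all? P? xs))

  ∑-cong-∈ : ∀ {g h : A → ℕ} xs → (∀ {x} → x ∈ xs → g x ≡ h x) → ∑ xs g ≡ ∑ xs h
  ∑-cong-∈ [] _ = refl
  ∑-cong-∈ (x ∷ xs) g≗h = cong₂ _+_ (g≗h (here refl)) (∑-cong-∈ xs (g≗h ∘ there))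

module FiniteSets where

  open import Data.Bool using (Bool; true; false; if_then_else_)
  open import Data.Fin using (Fin; zero; suc)
  open import Data.Fin.Subset using (Subset; _∈_; ∣_∣)
  open import Data.List using ([]; _∷_; map; filter; allFin)
  open import Data.List.Membership.Propositional using () renaming (_∈_ to _∈ₗ_)
  open import Data.List.Membership.Propositional.Properties
    using (∈-allFin; ∈-map⁺; ∈-concatMap⁺; ∈-filter⁺; ∈-filter⁻)
  import Data.List.Relation.Unary.Any as Any
  open import Data.List.Relation.Unary.Any using (here; there)
  import Data.List.Relation.Unary.All as All
  open import Data.List.Relation.Unary.All using (All)
  import Data.Nat as ℕ
  open import Data.Product using (∃; _×_; _,_; proj₂)
  open import Data.Vec using (Vec; []; _∷_; tabulate)
  open import Data.Vec.Properties using ([]=⇒lookup; lookup⇒[]=; lookup∘tabulate)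
  open import Function using (_∘_; _⇔_; mk⇔)
  open import Relation.Binary using (Rel; Transitive; Decidable)
  open import Relation.Binary.PropositionalEquality
  open import Relation.Nullary using (yes; no; ¬_; does)
  open import Relation.Nullary.Decidable using (_×-dec_; dec-true)
  open import Relation.Unary using (Pred) renaming (Decidable to Decidable₁)
  open FiniteSums

  ∈-allVecs : ∀ {m} k (v : Vec (Fin m) k) → v ∈ₗ allVecs (allFin m) k
  ∈-allVecs ℕ.zero [] = here refl
  ∈-allVecs {m} (ℕ.suc k) (y ∷ v) =
    ∈-concatMap⁺ (λ y′ → map (y′ ∷_) (allVecs (allFin m) k))
                 (Any.map (λ { refl → ∈-map⁺ (y ∷_) (∈-allVecs k v) }) (∈-allFin y))

  All-filter-allFin⇔ : ∀ {k p q} {P : Pred (Fin k) p} {Q : Pred (Fin k) q} (Q? : Decidable₁ Q) →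
                       All P (filter Q? (allFin k)) ⇔ (∀ i → Q i → P i)
  All-filter-allFin⇔ {k} Q? = mk⇔
    (λ all i Qi → All.lookup all (∈-filter⁺ Q? (∈-allFin i) Qi))
    (λ Q⇒P → All.tabulate (λ i∈ → Q⇒P _ (proj₂ (∈-filter⁻ Q? {xs = allFin k} i∈))))

  module _ {k p} {P : Pred (Fin k) p} (P? : Decidable₁ P) where

    fromDec : Subset k
    fromDec = tabulate (does ∘ P?)

    ∈-fromDec⁺ : ∀ {i} → P i → i ∈ fromDec
    ∈-fromDec⁺ {i} Pi = lookup⇒[]= i fromDec (trans (lookup∘tabulate (does ∘ P?) i) (dec-true (P? i) Pi))

    ∈-fromDec⁻ : ∀ {i} → i ∈ fromDec → P i
    ∈-fromDec⁻ {i} i∈ with P? i | trans (sym (lookup∘tabulate (does ∘ P?) i)) ([]=⇒lookup i∈)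
    ... | yes Pi | _ = Pi
    ... | no _ | ()

  ∣tabulate∣ : ∀ {k} (b : Fin k → Bool) → ∣ tabulate b ∣ ≡ ∑ᶠ (λ i → if b i then 1 else 0)
  ∣tabulate∣ {ℕ.zero} b = refl
  ∣tabulate∣ {ℕ.suc k} b with b zero
  ... | true = cong ℕ.suc (∣tabulate∣ (b ∘ suc))
  ... | false = ∣tabulate∣ (b ∘ suc)

  module _ {A : Set} {ℓ} {_<_ : Rel A ℓ}
           (<-trans : Transitive _<_) (<-irrefl : ∀ {x} → ¬ x < x) (_<?_ : Decidable _<_) where

    ∃-maximal : ∀ {p} {P : Pred A p} → Decidable₁ P → ∀ xs {x₀} → P x₀ →
                ∃ λ x → P x × (∀ {z} → z ∈ₗ xs → P z → ¬ x < z)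
    ∃-maximal P? [] {x₀} Px₀ = x₀ , Px₀ , λ ()
    ∃-maximal P? (z ∷ zs) Px₀ with ∃-maximal P? zs Px₀
    ... | x , Px , x-max with P? z ×-dec x <? z
    ...   | yes (Pz , x<z) = z , Pz , λ
      { (here refl) _ z<z → <-irrefl z<z
      ; (there w∈zs) Pw z<w → x-max w∈zs Pw (<-trans x<z z<w) }
    ...   | no ¬[Pz×x<z] = x , Px , λ
      { (here refl) Pz x<z → ¬[Pz×x<z] (Pz , x<z)
      ; (there w∈zs) → x-max w∈zs }

module MonomialCounting where

  open import Data.Bool using (if_then_else_)
  open import Data.Fin using (Fin; zero; suc)
  open import Data.List using (List; _∷_; map; filter; allFin; concatMap; upTo)
  open import Data.Nat using (ℕ; zero; suc; _+_; _*_; _∸_; _≤_; _<_; _≤?_; _≟_; s≤s)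
  open import Data.Nat.Combinatorics using (_C_; nCk+nC[k+1]≡[n+1]C[k+1]; k>n⇒nCk≡0)
  open import Data.Nat.Properties
  open import Algebra.Properties.CommutativeSemigroup +-commutativeSemigroup using (xy∙z≈xz∙y; xy∙z≈x∙zy)
  open import Data.Unit using (⊤; tt)
  open import Data.Vec using (Vec; _∷_; lookup)
  open import Function using (_∘_)
  open import Relation.Binary.PropositionalEquality
  open import Relation.Nullary using (Dec; yes; no; ¬_; does)
  open FiniteSums

  monomialCount : ℕ → ℕ → ℕ
  monomialCount zero zero = 1
  monomialCount zero (suc k) = 0
  monomialCount (suc d) k = ∑ᵣ (suc k) (λ c → monomialCount d (k ∸ c))

  monomialCount-0 : ∀ d → monomialCount d 0 ≡ 1
  monomialCount-0 zero = refl
  monomialCount-0 (suc d) = trans (+-identityʳ _) (monomialCount-0 d)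

  monomialCount≡C : ∀ d k → monomialCount d k ≡ (k + d ∸ 1) C k
  monomialCount≡C zero zero = refl
  monomialCount≡C zero (suc k) = sym (k>n⇒nCk≡0 (s≤s (≤-reflexive (+-identityʳ k))))
  monomialCount≡C (suc d) zero = monomialCount-0 (suc d)
  monomialCount≡C (suc d) (suc k) = begin
    monomialCount d (suc k) + monomialCount (suc d) k  ≡⟨ cong₂ _+_ (monomialCount≡C d (suc k))
                                                                    (monomialCount≡C (suc d) k) ⟩
    (k + d) C suc k + (k + suc d ∸ 1) C k
      ≡⟨ cong (λ u → (k + d) C suc k + (u ∸ 1) C k) (+-suc k d) ⟩
    (k + d) C suc k + (k + d) C k
      ≡⟨ +-comm ((k + d) C suc k) _ ⟩
    (k + d) C k + (k + d) C suc k
      ≡⟨ nCk+nC[k+1]≡[n+1]C[k+1] (k + d) k ⟩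
    suc (k + d) C suc k
      ≡⟨ cong (λ u → u C suc k) (sym (+-suc k d)) ⟩
    (k + suc d) C suc k ∎
    where open ≡-Reasoning

  -- the number of monomials of degree K in D variables that are divisible by a
  -- fixed monomial of degree R in these variables
  divisibleMonomials : ℕ → ℕ → ℕ → ℕ
  divisibleMonomials D R K = if does (R ≤? K) then monomialCount D (K ∸ R) else 0

  module _ (D : ℕ) {R K : ℕ} where

    divisibleMonomials-≤ : R ≤ K → divisibleMonomials D R K ≡ monomialCount D (K ∸ R)
    divisibleMonomials-≤ = if-yes (R ≤? K)

    divisibleMonomials-≰ : ¬ R ≤ K → divisibleMonomials D R K ≡ 0
    divisibleMonomials-≰ = if-no (R ≤? K)

  divisibleMonomials-0 : ∀ R K → divisibleMonomials 0 R K ≡ 𝟙 (R ≟ K)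
  divisibleMonomials-0 R K = go (R ≟ K)
    where
    go : (d : Dec (R ≡ K)) → divisibleMonomials 0 R K ≡ 𝟙 d
    go (yes refl) = trans (divisibleMonomials-≤ 0 (≤-refl {R})) (cong (monomialCount 0) (n∸n≡0 R))
    go (no R≢K) with R ≤? K
    ... | no R≰K = divisibleMonomials-≰ 0 R≰K
    ... | yes R≤K = trans (divisibleMonomials-≤ 0 R≤K) (cong (monomialCount 0) K∸R≡suc)
      where
      K∸R≡suc : K ∸ R ≡ suc (K ∸ suc R)
      K∸R≡suc = +-∸-assoc 1 {K} {suc R} (≤∧≢⇒< R≤K R≢K)

  ∑-divisibleMonomials : ∀ D R K A → K < A + R →
                         ∑ᵣ A (λ c → divisibleMonomials D (R + c) K) ≡ divisibleMonomials (suc D) R K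
  ∑-divisibleMonomials D R K A K<A+R with R ≤? K
  ... | no R≰K = begin
    ∑ᵣ A (λ c → divisibleMonomials D (R + c) K)
      ≡⟨ ∑ᵣ-zero A (λ c → divisibleMonomials-≰ D (R≰K ∘ R+c≤K⇒R≤K c)) ⟩
    0
      ≡⟨ divisibleMonomials-≰ (suc D) R≰K ⟨
    divisibleMonomials (suc D) R K ∎
    where
    open ≡-Reasoning
    R+c≤K⇒R≤K : ∀ c → R + c ≤ K → R ≤ K
    R+c≤K⇒R≤K c = ≤-trans (m≤m+n R c)
  ... | yes R≤K = begin
    ∑ᵣ A g                                       ≡⟨ cong (λ B → ∑ᵣ B g) (sym (m+[n∸m]≡n k<A)) ⟩
    ∑ᵣ (suc k + (A ∸ suc k)) g                   ≡⟨ ∑ᵣ-truncate (suc k) (A ∸ suc k) g beyond ⟩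
    ∑ᵣ (suc k) g                                 ≡⟨ ∑ᵣ-cong (suc k) within ⟩
    ∑ᵣ (suc k) (λ c → monomialCount D (k ∸ c))   ≡⟨ divisibleMonomials-≤ (suc D) R≤K ⟨
    divisibleMonomials (suc D) R K               ∎
    where
    open ≡-Reasoning
    g : ℕ → ℕ
    g c = divisibleMonomials D (R + c) K
    k : ℕ
    k = K ∸ R
    k<A : suc k ≤ A
    k<A = subst₂ _≤_ (+-∸-assoc 1 R≤K) (m+n∸n≡m A R) (∸-monoˡ-≤ R K<A+R)
    beyond : ∀ c → suc k ≤ c → g c ≡ 0
    beyond c k<c = divisibleMonomials-≰ D λ R+c≤K →
      <-irrefl refl (≤-trans k<c (subst (_≤ k) (m+n∸m≡n R c) (∸-monoˡ-≤ R R+c≤K)))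
    within : ∀ c → c < suc k → g c ≡ monomialCount D (k ∸ c)
    within c c≤k = trans (divisibleMonomials-≤ D R+c≤K) (cong (monomialCount D) (sym (∸-+-assoc K R c)))
      where
      R+c≤K : R + c ≤ K
      R+c≤K = subst (R + c ≤_) (m+[n∸m]≡n R≤K) (+-monoʳ-≤ R (≤-pred c≤k))

  data Cell : Set where
    forbidden free required : Cell

  Allowed : Cell → ℕ → Set
  Allowed forbidden c = c ≡ 0
  Allowed free c = ⊤
  Allowed required c = 1 ≤ c

  allowed? : ∀ t c → Dec (Allowed t c)
  allowed? forbidden c = c ≟ 0
  allowed? free c = yes tt
  allowed? required c = 1 ≤? c

  varCount reqCount : Cell → ℕ
  varCount forbidden = 0
  varCount free = 1
  varCount required = 1
  reqCount forbidden = 0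
  reqCount free = 0
  reqCount required = 1

  -- Letting one more block of exponents c range over cs, with multiplicity w c
  -- and degree s c, adds α variables and β to the degree of the divisor; cs
  -- only has to contain all exponents up to the degree bound B.
  ShiftsBy : {A : Set} → List A → (A → ℕ) → (A → ℕ) → (B α β : ℕ) → Set
  ShiftsBy cs w s B α β = ∀ D R K → K ≤ B →
    ∑[ c ∈ cs ] w c * divisibleMonomials D (R + s c) K ≡ divisibleMonomials (D + α) (R + β) K

  cell-shiftsBy : ∀ B t → ShiftsBy (upTo (suc B)) (𝟙 ∘ allowed? t) (λ c → c) B (varCount t) (reqCount t)
  cell-shiftsBy B t D R K K≤B = trans (∑-upTo (suc B) _) (go t)
    where
    open ≡-Reasoning
    M : ℕ → ℕ → ℕ
    M D′ R′ = divisibleMonomials D′ R′ K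
    K<B+R+1 : K < B + suc R
    K<B+R+1 = ≤-trans (s≤s (≤-trans K≤B (m≤m+n B R))) (≤-reflexive (sym (+-suc B R)))
    go : ∀ t → ∑ᵣ (suc B) (λ c → 𝟙 (allowed? t c) * M D (R + c)) ≡ M (D + varCount t) (R + reqCount t)
    go forbidden = begin
      M D (R + 0) + 0 + ∑ᵣ B (λ _ → 0)  ≡⟨ cong₂ _+_ (+-identityʳ _) (∑ᵣ-zero B (λ _ → refl)) ⟩
      M D (R + 0) + 0                   ≡⟨ +-identityʳ _ ⟩
      M D (R + 0)                       ≡⟨ cong (λ D′ → M D′ (R + 0)) (+-identityʳ D) ⟨
      M (D + 0) (R + 0)                 ∎
    go free = begin
      ∑ᵣ (suc B) (λ c → M D (R + c) + 0)
        ≡⟨ ∑ᵣ-cong (suc B) {h = λ c → M D (R + c)} (λ c _ → +-identityʳ _) ⟩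
      ∑ᵣ (suc B) (λ c → M D (R + c))
        ≡⟨ ∑-divisibleMonomials D R K (suc B) (s≤s (≤-trans K≤B (m≤m+n B R))) ⟩
      M (suc D) R
        ≡⟨ cong₂ M (+-comm D 1) (+-identityʳ R) ⟨
      M (D + 1) (R + 0) ∎
    go required = begin
      ∑ᵣ B (λ c → M D (R + suc c) + 0)  ≡⟨ ∑ᵣ-cong B {h = λ c → M D (suc R + c)} (λ c _ → shift c) ⟩
      ∑ᵣ B (λ c → M D (suc R + c))      ≡⟨ ∑-divisibleMonomials D (suc R) K B K<B+R+1 ⟩
      M (suc D) (suc R)                 ≡⟨ cong₂ M (+-comm D 1) (+-comm R 1) ⟨
      M (D + 1) (R + 1)                 ∎
      where
      shift : ∀ c → M D (R + suc c) + 0 ≡ M D (suc R + c)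
      shift c = trans (+-identityʳ _) (cong (M D) (+-suc R c))

  allVecs-shiftsBy : ∀ {A : Set} {cs : List A} {s : A → ℕ} {B} k (w : Fin k → A → ℕ) (α β : Fin k → ℕ) →
                     (∀ i → ShiftsBy cs (w i) s B (α i) (β i)) →
                     ShiftsBy (allVecs cs k) (λ v → ∏ᶠ (λ i → w i (lookup v i)))
                              (λ v → ∑ᶠ (λ i → s (lookup v i))) B (∑ᶠ α) (∑ᶠ β)
  allVecs-shiftsBy zero w α β _ D R K _ = begin
    1 * divisibleMonomials D (R + 0) K + 0  ≡⟨ +-identityʳ _ ⟩
    1 * divisibleMonomials D (R + 0) K      ≡⟨ *-identityˡ _ ⟩
    divisibleMonomials D (R + 0) K          ≡⟨ cong (λ D′ → divisibleMonomials D′ (R + 0) K) (+-identityʳ D) ⟨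
    divisibleMonomials (D + 0) (R + 0) K    ∎
    where open ≡-Reasoning
  allVecs-shiftsBy {A} {cs} {s} (suc k) w α β shifts D R K K≤B = begin
    ∑ (concatMap (λ c → map (c ∷_) vecs) cs) F
      ≡⟨ ∑-concatMap F _ cs ⟩
    ∑[ c ∈ cs ] ∑ (map (c ∷_) vecs) F
      ≡⟨ ∑-cong cs (λ c → ∑-map F (c ∷_) vecs) ⟩
    ∑[ c ∈ cs ] ∑[ v ∈ vecs ] F (c ∷ v)
      ≡⟨ ∑-cong cs (∑-cong vecs ∘ reassociate) ⟩
    ∑[ c ∈ cs ] ∑[ v ∈ vecs ] w₀ c * (W v * M D (R + s c + S v))
      ≡⟨ ∑-cong cs (λ c → ∑-*ˡ (w₀ c) _ vecs) ⟩
    ∑[ c ∈ cs ] w₀ c * (∑[ v ∈ vecs ] W v * M D (R + s c + S v))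
      ≡⟨ ∑-cong cs (cong (w₀ _ *_) ∘ tail) ⟩
    ∑[ c ∈ cs ] w₀ c * M D′ (R + s c + ∑ᶠ β′)
      ≡⟨ ∑-cong cs (cong (w₀ _ *_) ∘ swap) ⟩
    ∑[ c ∈ cs ] w₀ c * M D′ (R + ∑ᶠ β′ + s c)
      ≡⟨ shifts zero D′ (R + ∑ᶠ β′) K K≤B ⟩
    M (D + ∑ᶠ α′ + α zero) (R + ∑ᶠ β′ + β zero)
      ≡⟨ cong₂ M (xy∙z≈x∙zy D _ _) (xy∙z≈x∙zy R _ _) ⟩
    M (D + ∑ᶠ α) (R + ∑ᶠ β) ∎
    where
    open ≡-Reasoning
    vecs : List (Vec A k)
    vecs = allVecs cs k
    M : ℕ → ℕ → ℕ
    M D′ R′ = divisibleMonomials D′ R′ K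
    w₀ : A → ℕ
    w₀ = w zero
    W S : Vec A k → ℕ
    W v = ∏ᶠ (λ i → w (suc i) (lookup v i))
    S v = ∑ᶠ (λ i → s (lookup v i))
    F : Vec A (suc k) → ℕ
    F v = ∏ᶠ (λ i → w i (lookup v i)) * M D (R + ∑ᶠ (λ i → s (lookup v i)))
    α′ β′ : Fin k → ℕ
    α′ i = α (suc i)
    β′ i = β (suc i)
    D′ : ℕ
    D′ = D + ∑ᶠ α′
    reassociate : ∀ c v → F (c ∷ v) ≡ w₀ c * (W v * M D (R + s c + S v))
    reassociate c v =
      trans (*-assoc (w₀ c) (W v) _) (cong (λ r → w₀ c * (W v * M D r)) (sym (+-assoc R (s c) (S v))))
    tail : ∀ c → ∑[ v ∈ vecs ] W v * M D (R + s c + S v) ≡ M D′ (R + s c + ∑ᶠ β′)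
    tail c = allVecs-shiftsBy k (λ i → w (suc i)) α′ β′ (λ i → shifts (suc i)) D (R + s c) K K≤B
    swap : ∀ c → M D′ (R + s c + ∑ᶠ β′) ≡ M D′ (R + ∑ᶠ β′ + s c)
    swap c = cong (M D′) (xy∙z≈xz∙y R (s c) _)

  degree≡∑ᶠ : ∀ {n m} (a : Exp n m) → degree a ≡ ∑ᶠ (λ x → ∑ᶠ (a x))
  degree≡∑ᶠ {m = m} a = trans (∑-allFin (λ x → ∑ (allFin m) (a x))) (∑ᶠ-cong (λ x → ∑-allFin (a x)))

  ∑-expsOfDegree : ∀ {n m} (τ : Fin n → Fin m → Cell) N →
    ∑[ a ∈ expsOfDegree N ] ∏ᶠ (λ x → ∏ᶠ (λ y → 𝟙 (allowed? (τ x y) (a x y))))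
    ≡ divisibleMonomials (∑ᶠ (λ x → ∑ᶠ (λ y → varCount (τ x y)))) (∑ᶠ (λ x → ∑ᶠ (λ y → reqCount (τ x y)))) N
  ∑-expsOfDegree {n} {m} τ N = begin
    ∑ (filter (λ a → degree a ≟ N) (map toExp vecs)) W
      ≡⟨ ∑-filter (λ a → degree a ≟ N) W (map toExp vecs) ⟩
    ∑[ a ∈ map toExp vecs ] 𝟙 (degree a ≟ N) * W a
      ≡⟨ ∑-map (λ a → 𝟙 (degree a ≟ N) * W a) toExp vecs ⟩
    ∑[ v ∈ vecs ] 𝟙 (degree (toExp v) ≟ N) * W (toExp v)
      ≡⟨ ∑-cong vecs degree-indicator ⟩
    ∑[ v ∈ vecs ] W (toExp v) * divisibleMonomials 0 (S v) N
      ≡⟨ rows-shiftsBy 0 0 N ≤-refl ⟩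
    divisibleMonomials (∑ᶠ α) (∑ᶠ β) N ∎
    where
    open ≡-Reasoning
    vecs : List (Vec (Vec ℕ m) n)
    vecs = allVecs (allVecs (upTo (suc N)) m) n
    toExp : Vec (Vec ℕ m) n → Exp n m
    toExp v x y = lookup (lookup v x) y
    W : Exp n m → ℕ
    W a = ∏ᶠ (λ x → ∏ᶠ (λ y → 𝟙 (allowed? (τ x y) (a x y))))
    S : Vec (Vec ℕ m) n → ℕ
    S v = ∑ᶠ (λ x → ∑ᶠ (lookup (lookup v x)))
    α β : Fin n → ℕ
    α x = ∑ᶠ (λ y → varCount (τ x y))
    β x = ∑ᶠ (λ y → reqCount (τ x y))
    degree-indicator : ∀ v → 𝟙 (degree (toExp v) ≟ N) * W (toExp v) ≡ W (toExp v) * divisibleMonomials 0 (S v) N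
    degree-indicator v = trans (*-comm _ (W (toExp v))) (cong (W (toExp v) *_) (begin
      𝟙 (degree (toExp v) ≟ N)     ≡⟨ cong (λ d → 𝟙 (d ≟ N)) (degree≡∑ᶠ (toExp v)) ⟩
      𝟙 (S v ≟ N)                  ≡⟨ divisibleMonomials-0 (S v) N ⟨
      divisibleMonomials 0 (S v) N ∎))
    rowWeight : Fin n → Vec ℕ m → ℕ
    rowWeight x u = ∏ᶠ (λ y → 𝟙 (allowed? (τ x y) (lookup u y)))
    row-shiftsBy : ∀ x → ShiftsBy (allVecs (upTo (suc N)) m) (rowWeight x) (λ u → ∑ᶠ (lookup u)) N (α x) (β x)
    row-shiftsBy x = allVecs-shiftsBy m (λ y → 𝟙 ∘ allowed? (τ x y)) _ _ (λ y → cell-shiftsBy N (τ x y))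
    rows-shiftsBy : ShiftsBy vecs (λ v → ∏ᶠ (λ x → rowWeight x (lookup v x))) S N (∑ᶠ α) (∑ᶠ β)
    rows-shiftsBy = allVecs-shiftsBy n rowWeight α β row-shiftsBy

module SeriesCoefficients where

  open import Data.Bool using (true; false; if_then_else_; _∧_)
  open import Data.Bool.Properties using (if-float)
  open import Data.Empty using (⊥; ⊥-elim)
  open import Data.Fin using (Fin; _≟_)
  open import Data.Integer using (ℤ; +_; -_; _+_; _*_)
  import Data.Integer.Properties as ℤ
  open import Data.List using (List; []; _∷_; _++_; map; foldr)
  import Data.List.Relation.Unary.All as All
  open import Data.List.Relation.Unary.All using (All; []; _∷_)
  open import Data.List.Relation.Unary.All.Properties using (++⁺)
  import Data.List.Relation.Unary.AllPairs as AllPairs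
  open import Data.List.Relation.Unary.AllPairs using (AllPairs; []; _∷_)
  open import Data.List.Relation.Unary.Unique.Propositional using (Unique)
  open import Data.List.Properties using (map-cong)
  open import Data.Nat as ℕ using (ℕ; zero; suc; _≤_; z≤n)
  open import Data.Nat.ListAction using (product)
  import Data.Nat.Properties as ℕ
  open import Data.Product using (_×_; _,_; proj₁; proj₂)
  open import Data.Sum using (_⊎_; inj₁; inj₂)
  open import Function using (_∘_; _⇔_; mk⇔)
  open import Relation.Binary.PropositionalEquality
  open import Relation.Nullary using (Dec; yes; no; ¬_; does; ⌊_⌋)
  open import Relation.Nullary.Decidable using (_×-dec_; does-⇔; isYes≗does)
  open FiniteSums

  isYes-yes : ∀ {p} {P : Set p} (d : Dec P) → P → ⌊ d ⌋ ≡ true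
  isYes-yes (yes _) _ = refl
  isYes-yes (no ¬p) p = ⊥-elim (¬p p)

  module _ {p q} {P : Set p} {Q : Set q} where

    isYes-⇔ : P ⇔ Q → (d : Dec P) (e : Dec Q) → ⌊ d ⌋ ≡ ⌊ e ⌋
    isYes-⇔ P⇔Q d e = trans (isYes≗does d) (trans (does-⇔ P⇔Q d e) (sym (isYes≗does e)))

    isYes-× : (d : Dec P) (e : Dec Q) → ⌊ d ×-dec e ⌋ ≡ ⌊ d ⌋ ∧ ⌊ e ⌋
    isYes-× (yes _) (yes _) = refl
    isYes-× (yes _) (no _) = refl
    isYes-× (no _) _ = refl

  ∏ℤ : List ℤ → ℤ
  ∏ℤ = foldr _*_ (+ 1)

  sumℤ-+ : ∀ {A : Set} (g : A → ℕ) xs → sumℤ (map (λ x → + g x) xs) ≡ + ∑ xs g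
  sumℤ-+ g [] = refl
  sumℤ-+ g (x ∷ xs) = trans (cong (λ z → + g x + z) (sumℤ-+ g xs)) (sym (ℤ.pos-+ (g x) _))

  ∏ℤ-+ : ∀ {A : Set} (g : A → ℕ) xs → ∏ℤ (map (λ x → + g x) xs) ≡ + product (map g xs)
  ∏ℤ-+ g [] = refl
  ∏ℤ-+ g (x ∷ xs) = trans (cong (λ z → + g x * z) (∏ℤ-+ g xs)) (sym (ℤ.pos-* (g x) _))

  module _ {n m : ℕ} where

    Vars : Set₁
    Vars = Fin n → Fin m → Set

    VanishesOff VanishesOn : Vars → Exp n m → Set
    VanishesOff R e = ∀ x y → ¬ R x y → e x y ≡ 0
    VanishesOn R e = ∀ x y → R x y → e x y ≡ 0

    Disjoint : Vars → Vars → Set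
    Disjoint R S = ∀ x y → R x y → S x y → ⊥

    row : Fin n → Vars
    row x x′ _ = x′ ≡ x

    cell : Fin n → Fin m → Vars
    cell x y x′ y′ = x′ ≡ x × y′ ≡ y

    row-disjoint : ∀ {x x′} → x ≢ x′ → Disjoint (row x) (row x′)
    row-disjoint x≢x′ _ _ ≡x ≡x′ = x≢x′ (trans (sym ≡x) ≡x′)

    cell-disjoint : ∀ {x y y′} → y ≢ y′ → Disjoint (cell x y) (cell x y′)
    cell-disjoint y≢y′ _ _ (_ , ≡y) (_ , ≡y′) = y≢y′ (trans (sym ≡y) ≡y′)

    _+ₑ_ : Exp n m → Exp n m → Exp n m
    (e +ₑ e′) x y = e x y ℕ.+ e′ x y

    vanishesOff-+ : ∀ {R e e′} → VanishesOff R e → VanishesOff R e′ → VanishesOff R (e +ₑ e′)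
    vanishesOff-+ off off′ x y ¬r = cong₂ ℕ._+_ (off x y ¬r) (off′ x y ¬r)

    vanishesOn-+ : ∀ {R e e′} → VanishesOn R e → VanishesOn R e′ → VanishesOn R (e +ₑ e′)
    vanishesOn-+ on on′ x y r = cong₂ ℕ._+_ (on x y r) (on′ x y r)

    vanishesOff-mono : ∀ {R S e} → (∀ {x y} → R x y → S x y) → VanishesOff R e → VanishesOff S e
    vanishesOff-mono R⊆S off x y ¬s = off x y (¬s ∘ R⊆S)

    vanishesOff⇒vanishesOn : ∀ {R S e} → Disjoint R S → VanishesOff R e → VanishesOn S e
    vanishesOff⇒vanishesOn R#S off x y s = off x y (λ r → R#S x y r s)

    vanishesOff-vanishesOn-split : ∀ {R e e′} → VanishesOff R e → VanishesOn R e′ →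
                                   ∀ x y → e x y ≡ 0 ⊎ e′ x y ≡ 0
    vanishesOff-vanishesOn-split {e′ = e′} off on x y with e′ x y ℕ.≟ 0
    ... | yes e′≡0 = inj₂ e′≡0
    ... | no e′≢0 = inj₁ (off x y (e′≢0 ∘ on x y))

    unitExp : Fin n → Fin m → Exp n m
    unitExp x y x′ y′ = if ⌊ x ≟ x′ ⌋ ∧ ⌊ y ≟ y′ ⌋ then 1 else 0

    unitExp-diag : ∀ x y → unitExp x y x y ≡ 1
    unitExp-diag x y = cong₂ (λ b b′ → if b ∧ b′ then 1 else 0) (isYes-yes (x ≟ x) refl) (isYes-yes (y ≟ y) refl)

    unitExp-vanishesOff : ∀ x y → VanishesOff (cell x y) (unitExp x y)
    unitExp-vanishesOff x y x′ y′ ¬cell with x ≟ x′ | y ≟ y′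
    ... | yes refl | yes refl = ⊥-elim (¬cell (refl , refl))
    ... | yes _ | no _ = refl
    ... | no _ | _ = refl

    termMul : ℤ × Exp n m → ℤ × Exp n m → ℤ × Exp n m
    termMul (c , e) (c′ , e′) = c * c′ , e +ₑ e′

    AllExps : (Exp n m → Set) → Poly n m → Set
    AllExps P = All (P ∘ proj₂)

    module _ {P : Exp n m → Set} (P-+ : ∀ {e e′} → P e → P e′ → P (e +ₑ e′)) where

      AllExps-pmul : ∀ {p q} → AllExps P p → AllExps P q → AllExps P (pmul p q)
      AllExps-pmul [] _ = []
      AllExps-pmul {(c , e) ∷ p} {q} (Pe ∷ Pp) Pq = ++⁺ (times-e Pq) (AllExps-pmul Pp Pq)
        where
        times-e : ∀ {q} → AllExps P q → AllExps P (map (termMul (c , e)) q)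
        times-e [] = []
        times-e (Pe′ ∷ Pq) = P-+ Pe Pe′ ∷ times-e Pq

      AllExps-pprod : P (λ _ _ → 0) → {I : Set} (F : I → Poly n m) → ∀ {is} →
                      All (AllExps P ∘ F) is → AllExps P (pprod (map F is))
      AllExps-pprod P-0 F [] = P-0 ∷ []
      AllExps-pprod P-0 F (PFᵢ ∷ PFs) = AllExps-pmul PFᵢ (AllExps-pprod P-0 F PFs)

    pvar-vanishesOff : ∀ x y → AllExps (VanishesOff (cell x y)) (pvar x y)
    pvar-vanishesOff x y = unitExp-vanishesOff x y ∷ []

    1-pvar-vanishesOff : ∀ x y → AllExps (VanishesOff (cell x y)) (psub pone (pvar x y))
    1-pvar-vanishesOff x y = (λ _ _ _ → refl) ∷ unitExp-vanishesOff x y ∷ []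

    pprod-vanishesOn : {I : Set} (R : I → Vars) (P : I → Poly n m) → (∀ i → AllExps (VanishesOff (R i)) (P i)) →
                       ∀ {S} is → All (λ i → Disjoint (R i) S) is → AllExps (VanishesOn S) (pprod (map P is))
    pprod-vanishesOn R P off is Rs#S =
      AllExps-pprod vanishesOn-+ (λ _ _ _ → refl) P {is}
        (All.map (λ {i} Rᵢ#S → All.map (vanishesOff⇒vanishesOn Rᵢ#S) (off i)) Rs#S)

    rowFactor-vanishesOff : ∀ x y₀ ys →
      AllExps (VanishesOff (row x)) (pmul (psub pone (pvar x y₀)) (pprod (map (pvar x) ys)))
    rowFactor-vanishesOff x y₀ ys =
      AllExps-pmul vanishesOff-+ (All.map (vanishesOff-mono proj₁) (1-pvar-vanishesOff x y₀))
        (AllExps-pprod vanishesOff-+ (λ _ _ _ → refl) (pvar x) {ys}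
          (All.tabulate (λ {y} _ → All.map (vanishesOff-mono proj₁) (pvar-vanishesOff x y))))

    module _ (a : Exp n m) where

      termCoeff : ℤ × Exp n m → ℤ
      termCoeff (c , e) = if ⌊ e ≤ₑ? a ⌋ then c else + 0

      seriesCoeff-++ : ∀ p q → seriesCoeff (p ++ q) a ≡ seriesCoeff p a + seriesCoeff q a
      seriesCoeff-++ [] q = sym (ℤ.+-identityˡ _)
      seriesCoeff-++ ((c , e) ∷ p) q =
        trans (cong (λ z → termCoeff (c , e) + z) (seriesCoeff-++ p q))
              (sym (ℤ.+-assoc (termCoeff (c , e)) (seriesCoeff p a) (seriesCoeff q a)))

      seriesCoeff-psum : ∀ {I : Set} (P : I → Poly n m) is →
                         seriesCoeff (psum (map P is)) a ≡ sumℤ (map (λ i → seriesCoeff (P i) a) is)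
      seriesCoeff-psum P [] = refl
      seriesCoeff-psum P (i ∷ is) = trans (seriesCoeff-++ (P i) (psum (map P is)))
                                          (cong (λ z → seriesCoeff (P i) a + z) (seriesCoeff-psum P is))

      seriesCoeff-pneg : ∀ p → seriesCoeff (pneg p) a ≡ - seriesCoeff p a
      seriesCoeff-pneg [] = refl
      seriesCoeff-pneg ((c , e) ∷ p) = trans (cong₂ _+_ (if-neg ⌊ e ≤ₑ? a ⌋) (seriesCoeff-pneg p))
                                             (sym (ℤ.neg-distrib-+ (termCoeff (c , e)) (seriesCoeff p a)))
        where
        if-neg : ∀ b → (if b then - c else + 0) ≡ - (if b then c else + 0)
        if-neg true = refl
        if-neg false = refl

      seriesCoeff-pone : seriesCoeff pone a ≡ + 1
      seriesCoeff-pone =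
        trans (ℤ.+-identityʳ _)
              (cong (λ b → if b then + 1 else + 0) (isYes-yes ((λ _ _ → 0) ≤ₑ? a) (λ _ _ → z≤n)))

      seriesCoeff-pvar : ∀ x y → seriesCoeff (pvar x y) a ≡ + 𝟙 (1 ℕ.≤? a x y)
      seriesCoeff-pvar x y = begin
        (if ⌊ unitExp x y ≤ₑ? a ⌋ then + 1 else + 0) + + 0
          ≡⟨ ℤ.+-identityʳ _ ⟩
        (if ⌊ unitExp x y ≤ₑ? a ⌋ then + 1 else + 0)
          ≡⟨ cong (λ b → if b then + 1 else + 0) unit≤a⇔1≤a ⟩
        (if does (1 ℕ.≤? a x y) then + 1 else + 0)
          ≡⟨ if-float +_ (does (1 ℕ.≤? a x y)) ⟨
        + 𝟙 (1 ℕ.≤? a x y) ∎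
        where
        open ≡-Reasoning
        at-unit : (∀ x′ y′ → unitExp x y x′ y′ ≤ a x′ y′) → 1 ≤ a x y
        at-unit unit≤a = subst (_≤ a x y) (unitExp-diag x y) (unit≤a x y)
        from-unit : 1 ≤ a x y → ∀ x′ y′ → unitExp x y x′ y′ ≤ a x′ y′
        from-unit 1≤a x′ y′ with x ≟ x′ | y ≟ y′
        ... | yes refl | yes refl = 1≤a
        ... | yes _ | no _ = z≤n
        ... | no _ | _ = z≤n
        unit≤a⇔1≤a : ⌊ unitExp x y ≤ₑ? a ⌋ ≡ does (1 ℕ.≤? a x y)
        unit≤a⇔1≤a = trans (isYes-⇔ (mk⇔ at-unit from-unit) (unitExp x y ≤ₑ? a) (1 ℕ.≤? a x y)) (isYes≗does _)

      termCoeff-termMul : ∀ c c′ {e e′ : Exp n m} → (∀ x y → e x y ≡ 0 ⊎ e′ x y ≡ 0) →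
                          termCoeff (termMul (c , e) (c′ , e′)) ≡ termCoeff (c , e) * termCoeff (c′ , e′)
      termCoeff-termMul c c′ {e} {e′} disjoint = begin
        (if ⌊ (e +ₑ e′) ≤ₑ? a ⌋ then c * c′ else + 0)
          ≡⟨ cong (λ b → if b then c * c′ else + 0) split ⟩
        (if ⌊ e ≤ₑ? a ⌋ ∧ ⌊ e′ ≤ₑ? a ⌋ then c * c′ else + 0)
          ≡⟨ if-∧-* ⌊ e ≤ₑ? a ⌋ ⌊ e′ ≤ₑ? a ⌋ ⟩
        termCoeff (c , e) * termCoeff (c′ , e′) ∎
        where
        open ≡-Reasoning
        bounded : ∀ {x y} → e x y ≤ a x y → e′ x y ≤ a x y → (e +ₑ e′) x y ≤ a x y
        bounded {x} {y} e≤a e′≤a with disjoint x y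
        ... | inj₁ e≡0 rewrite e≡0 = e′≤a
        ... | inj₂ e′≡0 rewrite e′≡0 | ℕ.+-identityʳ (e x y) = e≤a
        +ₑ≤⇔ : (∀ x y → (e +ₑ e′) x y ≤ a x y) ⇔ ((∀ x y → e x y ≤ a x y) × (∀ x y → e′ x y ≤ a x y))
        +ₑ≤⇔ = mk⇔ (λ h → (λ x y → ℕ.≤-trans (ℕ.m≤m+n _ _) (h x y)) , (λ x y → ℕ.≤-trans (ℕ.m≤n+m _ _) (h x y)))
                   (λ (h , h′) x y → bounded (h x y) (h′ x y))
        split : ⌊ (e +ₑ e′) ≤ₑ? a ⌋ ≡ ⌊ e ≤ₑ? a ⌋ ∧ ⌊ e′ ≤ₑ? a ⌋
        split = trans (isYes-⇔ +ₑ≤⇔ ((e +ₑ e′) ≤ₑ? a) (e ≤ₑ? a ×-dec e′ ≤ₑ? a)) (isYes-× (e ≤ₑ? a) (e′ ≤ₑ? a))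
        if-∧-* : ∀ b b′ → (if b ∧ b′ then c * c′ else + 0) ≡ (if b then c else + 0) * (if b′ then c′ else + 0)
        if-∧-* true true = refl
        if-∧-* true false = sym (ℤ.*-zeroʳ c)
        if-∧-* false _ = refl

      seriesCoeff-pmul : ∀ R {p q} → AllExps (VanishesOff R) p → AllExps (VanishesOn R) q →
                         seriesCoeff (pmul p q) a ≡ seriesCoeff p a * seriesCoeff q a
      seriesCoeff-pmul R [] _ = refl
      seriesCoeff-pmul R {(c , e) ∷ p} {q} (off ∷ offs) ons = begin
        seriesCoeff (map (termMul (c , e)) q ++ pmul p q) a
          ≡⟨ seriesCoeff-++ (map (termMul (c , e)) q) _ ⟩
        seriesCoeff (map (termMul (c , e)) q) a + seriesCoeff (pmul p q) a
          ≡⟨ cong₂ _+_ (times-e ons) (seriesCoeff-pmul R offs ons) ⟩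
        t * seriesCoeff q a + seriesCoeff p a * seriesCoeff q a
          ≡⟨ ℤ.*-distribʳ-+ (seriesCoeff q a) t _ ⟨
        (t + seriesCoeff p a) * seriesCoeff q a ∎
        where
        open ≡-Reasoning
        t : ℤ
        t = termCoeff (c , e)
        times-e : ∀ {q} → AllExps (VanishesOn R) q → seriesCoeff (map (termMul (c , e)) q) a ≡ t * seriesCoeff q a
        times-e [] = sym (ℤ.*-zeroʳ t)
        times-e {(c′ , e′) ∷ q} (on ∷ ons) = begin
          termCoeff (termMul (c , e) (c′ , e′)) + seriesCoeff (map (termMul (c , e)) q) a
            ≡⟨ cong₂ _+_ (termCoeff-termMul c c′ (vanishesOff-vanishesOn-split off on)) (times-e ons) ⟩
          t * termCoeff (c′ , e′) + t * seriesCoeff q a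
            ≡⟨ ℤ.*-distribˡ-+ t (termCoeff (c′ , e′)) (seriesCoeff q a) ⟨
          t * seriesCoeff ((c′ , e′) ∷ q) a
            ∎

      seriesCoeff-pprod : {I : Set} (R : I → Vars) (P : I → Poly n m) → (∀ i → AllExps (VanishesOff (R i)) (P i)) →
                          ∀ is → AllPairs (λ i j → Disjoint (R i) (R j)) is →
                          seriesCoeff (pprod (map P is)) a ≡ ∏ℤ (map (λ i → seriesCoeff (P i) a) is)
      seriesCoeff-pprod R P off [] [] = seriesCoeff-pone
      seriesCoeff-pprod R P off (i ∷ is) (Rᵢ#Rs ∷ pairwise) =
        trans (seriesCoeff-pmul (R i) (off i)
                                (pprod-vanishesOn R P off is (All.map (λ d x y s r → d x y r s) Rᵢ#Rs)))
              (cong (λ z → seriesCoeff (P i) a * z) (seriesCoeff-pprod R P off is pairwise))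

      seriesCoeff-1-pvar : ∀ x y → seriesCoeff (psub pone (pvar x y)) a ≡ + 𝟙 (a x y ℕ.≟ 0)
      seriesCoeff-1-pvar x y = begin
        seriesCoeff (pone ++ pneg (pvar x y)) a
          ≡⟨ seriesCoeff-++ pone (pneg (pvar x y)) ⟩
        seriesCoeff pone a + seriesCoeff (pneg (pvar x y)) a
          ≡⟨ cong₂ _+_ seriesCoeff-pone (seriesCoeff-pneg (pvar x y)) ⟩
        + 1 + - seriesCoeff (pvar x y) a
          ≡⟨ cong (λ z → + 1 + - z) (seriesCoeff-pvar x y) ⟩
        + 1 + - (+ 𝟙 (1 ℕ.≤? a x y))
          ≡⟨ 1-[1≤k]≡[k≡0] (a x y) ⟩
        + 𝟙 (a x y ℕ.≟ 0) ∎
        where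
        open ≡-Reasoning
        1-[1≤k]≡[k≡0] : ∀ k → + 1 + - (+ 𝟙 (1 ℕ.≤? k)) ≡ + 𝟙 (k ℕ.≟ 0)
        1-[1≤k]≡[k≡0] zero = refl
        1-[1≤k]≡[k≡0] (suc k) = refl

      seriesCoeff-pprod-pvar : ∀ x ys → Unique ys →
                               seriesCoeff (pprod (map (pvar x) ys)) a ≡ + 𝟙 (All.all? (λ y → 1 ℕ.≤? a x y) ys)
      seriesCoeff-pprod-pvar x ys unique = begin
        seriesCoeff (pprod (map (pvar x) ys)) a
          ≡⟨ seriesCoeff-pprod (cell x) (pvar x) (pvar-vanishesOff x) ys cells# ⟩
        ∏ℤ (map (λ y → seriesCoeff (pvar x y) a) ys)
          ≡⟨ cong ∏ℤ (map-cong (seriesCoeff-pvar x) ys) ⟩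
        ∏ℤ (map (λ y → + 𝟙 (1 ℕ.≤? a x y)) ys)
          ≡⟨ ∏ℤ-+ (λ y → 𝟙 (1 ℕ.≤? a x y)) ys ⟩
        + product (map (λ y → 𝟙 (1 ℕ.≤? a x y)) ys)
          ≡⟨ cong +_ (product-𝟙 (λ y → 1 ℕ.≤? a x y) ys) ⟩
        + 𝟙 (All.all? (λ y → 1 ℕ.≤? a x y) ys) ∎
        where
        open ≡-Reasoning
        cells# : AllPairs (λ y y′ → Disjoint (cell x y) (cell x y′)) ys
        cells# = AllPairs.map cell-disjoint unique

      seriesCoeff-rowFactor : ∀ x y₀ ys → Unique ys → All (_≢ y₀) ys →
        seriesCoeff (pmul (psub pone (pvar x y₀)) (pprod (map (pvar x) ys))) a
        ≡ + (𝟙 (a x y₀ ℕ.≟ 0) ℕ.* 𝟙 (All.all? (λ y → 1 ℕ.≤? a x y) ys))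
      seriesCoeff-rowFactor x y₀ ys unique ys≢y₀ = begin
        seriesCoeff (pmul (psub pone (pvar x y₀)) (pprod (map (pvar x) ys))) a
          ≡⟨ seriesCoeff-pmul (cell x y₀) (1-pvar-vanishesOff x y₀) ys-off-y₀ ⟩
        seriesCoeff (psub pone (pvar x y₀)) a * seriesCoeff (pprod (map (pvar x) ys)) a
          ≡⟨ cong₂ _*_ (seriesCoeff-1-pvar x y₀) (seriesCoeff-pprod-pvar x ys unique) ⟩
        + 𝟙 (a x y₀ ℕ.≟ 0) * + 𝟙 (All.all? (λ y → 1 ℕ.≤? a x y) ys)
          ≡⟨ ℤ.pos-* (𝟙 (a x y₀ ℕ.≟ 0)) _ ⟨
        + (𝟙 (a x y₀ ℕ.≟ 0) ℕ.* 𝟙 (All.all? (λ y → 1 ℕ.≤? a x y) ys))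
          ∎
        where
        open ≡-Reasoning
        ys-off-y₀ : AllExps (VanishesOn (cell x y₀)) (pprod (map (pvar x) ys))
        ys-off-y₀ = pprod-vanishesOn (cell x) (pvar x) (pvar-vanishesOff x) ys (All.map cell-disjoint ys≢y₀)

module TableauTheory (D : TableauData) where

  open import Data.Bool using (true; false; if_then_else_)
  open import Data.Empty using (⊥; ⊥-elim)
  open import Data.Fin using (Fin; _≟_)
  open import Data.Fin.Properties using (all?)
  open import Data.Fin.Subset using (_∈_; _∉_; _⊆_; ∣_∣)
  open import Data.Fin.Subset.Properties using (_∈?_; p⊆q⇒∣p∣≤∣q∣)
  open import Data.Integer using (+_)
  open import Data.List using (List; _∷_; map; filter; allFin; foldr; upTo)
  open import Data.List.Membership.Propositional using (find; lose) renaming (_∈_ to _∈ₗ_)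
  open import Data.List.Membership.Propositional.Properties using (∈-allFin; ∈-filter⁺; ∈-filter⁻)
  open import Data.List.Properties using (foldr-preservesᵇ; map-cong)
  import Data.List.Relation.Unary.All as All
  open import Data.List.Relation.Unary.All using (All; _∷_)
  open import Data.List.Relation.Unary.All.Properties using (all-filter; tabulate⁺; tabulate⁻)
  import Data.List.Relation.Unary.AllPairs as AllPairs
  open import Data.List.Relation.Unary.AllPairs using (AllPairs)
  open import Data.List.Relation.Unary.Any using (here; there; any?)
  open import Data.List.Relation.Unary.Unique.Propositional using (Unique)
  import Data.List.Relation.Unary.Unique.Propositional.Properties as Unique
  open import Data.Nat as ℕ using (ℕ; _≤_)
  open import Data.Nat.ListAction using (product)
  import Data.Nat.Properties as ℕ
  open import Data.Product using (∃; _×_; _,_; proj₁; proj₂)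
  open import Data.Product.Function.NonDependent.Propositional using (_×-⇔_)
  open import Data.Sum using (inj₁; inj₂)
  open import Data.Unit using (tt)
  open import Data.Vec using (_∷_; lookup; tabulate; _[_]≔_)
  open import Data.Vec.Properties
    using (lookup∘tabulate; lookup∘update; lookup∘update′; tabulate∘lookup; tabulate-cong)
  open import Function using (_∘_; _⇔_; mk⇔; Equivalence)
  open import Function.Properties.Equivalence using () renaming (refl to ⇔-refl)
  open import Level using (0ℓ)
  open import Relation.Binary using (Rel)
  import Relation.Binary.Construct.NonStrictToStrict as NonStrictToStrict
  open import Relation.Binary.PropositionalEquality
  open import Relation.Binary.Structures using (IsDecPartialOrder)
  open import Relation.Nullary using (Dec; yes; no; ¬_; does)
  open import Relation.Nullary.Decidable using (_×-dec_; _→-dec_; ¬?; decidable-stable)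
  import Relation.Nullary.Decidable as Dec
  open import Relation.Unary using (Pred) renaming (Decidable to Decidable₁)
  open FiniteSums
  open FiniteSets
  open MonomialCounting
  open SeriesCoefficients

  open TableauData D
  open Tableaux D

  private
    module ≤X = IsDecPartialOrder isPosetX
    module ≤Y = IsDecPartialOrder isPosetY
    module <X = NonStrictToStrict _≡_ _≤X_
    module <Y = NonStrictToStrict _≡_ _≤Y_

  _<X_ : Rel (Fin n) 0ℓ
  _<X_ = <X._<_

  <Y-≤Y-trans : ∀ {y y′ y″} → y <Y y′ → y′ ≤Y y″ → y <Y y″
  <Y-≤Y-trans = <Y.<-≤-trans sym ≤Y.trans ≤Y.antisym ≤Y.≲-respʳ-≈

  ≤Y-<Y-trans : ∀ {y y′ y″} → y ≤Y y′ → y′ <Y y″ → y <Y y″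
  ≤Y-<Y-trans = <Y.≤-<-trans ≤Y.trans ≤Y.antisym ≤Y.≲-respˡ-≈

  _≤T_ : Rel Tableau 0ℓ
  f ≤T g = ∀ x → lookup f x ≤Y lookup g x

  joinY : Fin m → Fin m → Fin m
  joinY y y′ = if does (y ≤Y.≤? y′) then y′ else y

  joinY-elim : ∀ (Q : Fin m → Set) {y y′} → Q y → Q y′ → Q (joinY y y′)
  joinY-elim Q {y} {y′} Qy Qy′ with does (y ≤Y.≤? y′)
  ... | true = Qy′
  ... | false = Qy

  joinY-upper : ∀ x {y y′} → y ∈ Yx x → y′ ∈ Yx x → y ≤Y joinY y y′ × y′ ≤Y joinY y y′
  joinY-upper x {y} {y′} y∈Yx y′∈Yx with y ≤Y.≤? y′
  ... | yes y≤y′ = y≤y′ , ≤Y.refl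
  ... | no y≰y′ with Yx-total x y∈Yx y′∈Yx
  ...   | inj₁ y≤y′ = ⊥-elim (y≰y′ y≤y′)
  ...   | inj₂ y′≤y = ≤Y.refl , y′≤y

  _⊔_ : Tableau → Tableau → Tableau
  f ⊔ g = tabulate (λ x → joinY (lookup f x) (lookup g x))

  ⊔-elim : ∀ (Q : Fin m → Set) f g x → Q (lookup f x) → Q (lookup g x) → Q (lookup (f ⊔ g) x)
  ⊔-elim Q f g x Qf Qg = subst Q (sym (lookup∘tabulate _ x)) (joinY-elim Q Qf Qg)

  ⊔-upper : ∀ f g → InT f → InT g → f ≤T (f ⊔ g) × g ≤T (f ⊔ g)
  ⊔-upper f g (f∈Yx , _) (g∈Yx , _) = (λ x → proj₁ (upper x)) , (λ x → proj₂ (upper x))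
    where
    upper : ∀ x → lookup f x ≤Y lookup (f ⊔ g) x × lookup g x ≤Y lookup (f ⊔ g) x
    upper x = subst (λ y → lookup f x ≤Y y × lookup g x ≤Y y) (sym (lookup∘tabulate _ x))
                    (joinY-upper x (f∈Yx x) (g∈Yx x))

  ⊔-InT : ∀ f g → InT f → InT g → InT (f ⊔ g)
  ⊔-InT f g tf@(f∈Yx , f-mono , f-strict) tg@(g∈Yx , g-mono , g-strict) = ∈Yx , mono , strict
    where
    f≤ : f ≤T (f ⊔ g)
    f≤ = proj₁ (⊔-upper f g tf tg)
    g≤ : g ≤T (f ⊔ g)
    g≤ = proj₂ (⊔-upper f g tf tg)
    ∈Yx : ∀ x → lookup (f ⊔ g) x ∈ Yx x
    ∈Yx x = ⊔-elim (_∈ Yx x) f g x (f∈Yx x) (g∈Yx x)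
    mono : ∀ x₁ x₂ → x₁ ≤X x₂ → lookup (f ⊔ g) x₁ ≤Y lookup (f ⊔ g) x₂
    mono x₁ x₂ x₁≤x₂ = ⊔-elim (_≤Y lookup (f ⊔ g) x₂) f g x₁
      (≤Y.trans (f-mono x₁ x₂ x₁≤x₂) (f≤ x₂)) (≤Y.trans (g-mono x₁ x₂ x₁≤x₂) (g≤ x₂))
    strict : ∀ x₁ x₂ → x₂ ∈ Ψ x₁ → lookup (f ⊔ g) x₁ <Y lookup (f ⊔ g) x₂
    strict x₁ x₂ x₂∈Ψ = ⊔-elim (_<Y lookup (f ⊔ g) x₂) f g x₁
      (<Y-≤Y-trans (f-strict x₁ x₂ x₂∈Ψ) (f≤ x₂)) (<Y-≤Y-trans (g-strict x₁ x₂ x₂∈Ψ) (g≤ x₂))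

  ⨆-upper : ∀ {f₀ fs} → InT f₀ → All InT fs → ∀ {g} → g ∈ₗ fs → g ≤T foldr _⊔_ f₀ fs
  ⨆-upper {f₀} {h ∷ fs} t₀ (th ∷ ts) {g} g∈h∷fs = go g∈h∷fs
    where
    ⨆fs : Tableau
    ⨆fs = foldr _⊔_ f₀ fs
    h,⨆fs≤ : h ≤T (h ⊔ ⨆fs) × ⨆fs ≤T (h ⊔ ⨆fs)
    h,⨆fs≤ = ⊔-upper h ⨆fs th (foldr-preservesᵇ (λ {f} {g} → ⊔-InT f g) t₀ ts)
    go : g ∈ₗ h ∷ fs → g ≤T (h ⊔ ⨆fs)
    go (here refl) = proj₁ h,⨆fs≤
    go (there g∈fs) x = ≤Y.trans (⨆-upper t₀ ts g∈fs x) (proj₂ h,⨆fs≤ x)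

  ∈Tlist⁺ : ∀ {f} → InT f → f ∈ₗ Tlist
  ∈Tlist⁺ {f} tf = ∈-filter⁺ InT? (∈-allVecs n f) tf

  ∈Tlist⁻ : ∀ {f} → f ∈ₗ Tlist → InT f
  ∈Tlist⁻ f∈T = proj₂ (∈-filter⁻ InT? {xs = allVecs (allFin m) n} f∈T)

  ∃T? : ∀ {p} {P : Pred Tableau p} → Decidable₁ P → Dec (∃ λ f → InT f × P f)
  ∃T? P? = Dec.map′ (λ any → let f , f∈T , Pf = find any in f , ∈Tlist⁻ f∈T , Pf)
                    (λ (f , tf , Pf) → lose (∈Tlist⁺ tf) Pf)
                    (any? P? Tlist)

  InE? : ∀ x y → Dec (InE x y)
  InE? x y = ∃T? (λ f → lookup f x ≟ y)

  InU⇒InE : ∀ {f x y} → InU f x y → InE x y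
  InU⇒InE {f} {x} {y} (_ , t′) = f [ x ]≔ y , t′ , lookup∘update x f y

  raise-InT : ∀ f h x → InT f → InT h → f ≤T h → (∀ z → x <X z → lookup f z ≡ lookup h z) →
              InT (f [ x ]≔ lookup h x)
  raise-InT f h x (f∈Yx , f-mono , f-strict) (h∈Yx , h-mono , h-strict) f≤h agree = ∈Yx , mono , strict
    where
    g : Tableau
    g = f [ x ]≔ lookup h x
    g-at-x : lookup g x ≡ lookup h x
    g-at-x = lookup∘update x f (lookup h x)
    g-off-x : ∀ {z} → z ≢ x → lookup g z ≡ lookup f z
    g-off-x z≢x = lookup∘update′ z≢x f (lookup h x)
    ∈Yx : ∀ z → lookup g z ∈ Yx z
    ∈Yx z with z ≟ x
    ... | yes refl rewrite g-at-x = h∈Yx x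
    ... | no z≢x rewrite g-off-x z≢x = f∈Yx z
    mono : ∀ z₁ z₂ → z₁ ≤X z₂ → lookup g z₁ ≤Y lookup g z₂
    mono z₁ z₂ z₁≤z₂ with z₁ ≟ x | z₂ ≟ x
    ... | yes refl | yes refl = ≤Y.refl
    ... | yes refl | no z₂≢x rewrite g-at-x | g-off-x z₂≢x | agree z₂ (z₁≤z₂ , z₂≢x ∘ sym) = h-mono x z₂ z₁≤z₂
    ... | no z₁≢x | yes refl rewrite g-off-x z₁≢x | g-at-x = ≤Y.trans (f≤h z₁) (h-mono z₁ x z₁≤z₂)
    ... | no z₁≢x | no z₂≢x rewrite g-off-x z₁≢x | g-off-x z₂≢x = f-mono z₁ z₂ z₁≤z₂
    strict : ∀ z₁ z₂ → z₂ ∈ Ψ z₁ → lookup g z₁ <Y lookup g z₂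
    strict z₁ z₂ z₂∈Ψ with z₁ ≟ x | z₂ ≟ x
    ... | yes refl | yes refl = ⊥-elim (proj₂ (Ψ-strict z₂∈Ψ) refl)
    ... | yes refl | no z₂≢x rewrite g-at-x | g-off-x z₂≢x | agree z₂ (Ψ-strict z₂∈Ψ) = h-strict x z₂ z₂∈Ψ
    ... | no z₁≢x | yes refl rewrite g-off-x z₁≢x | g-at-x = ≤Y-<Y-trans (f≤h z₁) (h-strict z₁ x z₂∈Ψ)
    ... | no z₁≢x | no z₂≢x rewrite g-off-x z₁≢x | g-off-x z₂≢x = f-strict z₁ z₂ z₂∈Ψ

  isFace⇔missed : ∀ G → (∀ x y → y ∈ G x → InE x y) →
                  IsFace G ⇔ (∃ λ f → InT f × ∀ x → lookup f x ∉ G x)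
  isFace⇔missed G G⊆E = mk⇔ face⇒missed missed⇒face
    where
    face⇒missed : IsFace G → ∃ λ f → InT f × ∀ x → lookup f x ∉ G x
    face⇒missed (F , _ , (f , tf , f⊆F) , G≡E∖F) =
      f , tf , λ x fx∈G → proj₂ (proj₁ (G≡E∖F x (lookup f x)) fx∈G) (f⊆F x)
    missed⇒face : (∃ λ f → InT f × ∀ x → lookup f x ∉ G x) → IsFace G
    missed⇒face (f , tf , f-misses) = F , F⊆E , (f , tf , f⊆F) , G≡E∖F
      where
      E∖G? : ∀ x → Decidable₁ (λ y → InE x y × y ∉ G x)
      E∖G? x y = InE? x y ×-dec ¬? (y ∈? G x)
      F : SubsetXY
      F x = fromDec (E∖G? x)
      F⊆E : ∀ x y → y ∈ F x → InE x y
      F⊆E x y y∈F = proj₁ (∈-fromDec⁻ (E∖G? x) y∈F)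
      f⊆F : ∀ x → lookup f x ∈ F x
      f⊆F x = ∈-fromDec⁺ (E∖G? x) ((f , tf , refl) , f-misses x)
      G≡E∖F : ∀ x y → (y ∈ G x → InE x y × y ∉ F x) × (InE x y × y ∉ F x → y ∈ G x)
      G≡E∖F x y = (λ y∈G → G⊆E x y y∈G , λ y∈F → proj₂ (∈-fromDec⁻ (E∖G? x) y∈F) y∈G)
                , (λ (y∈E , y∉F) → decidable-stable (y ∈? G x) (λ y∉G → y∉F (∈-fromDec⁺ (E∖G? x) (y∈E , y∉G))))

  offGraph? : ∀ f x → Decidable₁ (λ y → InE x y × y ≢ lookup f x)
  offGraph? f x y = InE? x y ×-dec ¬? (y ≟ lookup f x)

  classify : ∀ {p q} {P : Set p} {Q : Set q} → Dec P → Dec Q → Cell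
  classify (yes _) _ = required
  classify (no _) (yes _) = free
  classify (no _) (no _) = forbidden

  -- The Stanley decomposition: the monomials of S/I_Δ attached to f are those
  -- divisible by the product over U_f, in the variables of E off the graph of f.
  cellType : Tableau → Fin n → Fin m → Cell
  cellType f x y = classify (InU? f x y) (offGraph? f x y)

  module _ {f : Tableau} {x : Fin n} {y : Fin m} where

    classify-allowed⇔ : ∀ {c} (u? : Dec (InU f x y)) (v? : Dec (InE x y × y ≢ lookup f x)) →
                        Allowed (classify u? v?) c ⇔
                        ((¬ InE x y → c ≡ 0) × (y ≡ lookup f x → c ≡ 0) × (InU f x y → 1 ≤ c))
    classify-allowed⇔ (yes u) _ = mk⇔
      (λ 1≤c → (λ ¬e → ⊥-elim (¬e (InU⇒InE {f} u))) , (λ { refl → ⊥-elim (proj₂ (proj₁ u) refl) }) , (λ _ → 1≤c))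
      (λ (_ , _ , U⇒1≤c) → U⇒1≤c u)
    classify-allowed⇔ (no ¬u) (yes (e , y≢fx)) = mk⇔
      (λ _ → (λ ¬e → ⊥-elim (¬e e)) , (λ y≡fx → ⊥-elim (y≢fx y≡fx)) , (λ u → ⊥-elim (¬u u)))
      (λ _ → tt)
    classify-allowed⇔ {c} (no ¬u) (no ¬v) = mk⇔ (λ c≡0 → (λ _ → c≡0) , (λ _ → c≡0) , (λ u → ⊥-elim (¬u u))) from
      where
      from : (¬ InE x y → c ≡ 0) × (y ≡ lookup f x → c ≡ 0) × (InU f x y → 1 ≤ c) → c ≡ 0
      from (off-E , on-graph , _) with InE? x y | y ≟ lookup f x
      ... | no ¬e | _ = off-E ¬e
      ... | yes _ | yes y≡fx = on-graph y≡fx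
      ... | yes e | no y≢fx = ⊥-elim (¬v (e , y≢fx))

    classify-reqCount : ∀ (u? : Dec (InU f x y)) (v? : Dec (InE x y × y ≢ lookup f x)) →
                        reqCount (classify u? v?) ≡ 𝟙 u?
    classify-reqCount (yes _) _ = refl
    classify-reqCount (no _) (yes _) = refl
    classify-reqCount (no _) (no _) = refl

    classify-varCount : ∀ (u? : Dec (InU f x y)) (v? : Dec (InE x y × y ≢ lookup f x)) →
                        varCount (classify u? v?) ≡ 𝟙 v?
    classify-varCount (yes u) v? = sym (𝟙-yes v? (InU⇒InE {f} u , λ y≡fx → proj₂ (proj₁ u) (sym y≡fx)))
    classify-varCount (no _) (yes _) = refl
    classify-varCount (no _) (no _) = refl

  offGraphCount : Tableau → ℕ
  offGraphCount f = ∑ᶠ (λ x → ∑ᶠ (λ y → 𝟙 (offGraph? f x y)))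

  offGraphCount-row : ∀ f → InT f → ∀ x → ∑ᶠ (λ y → 𝟙 (offGraph? f x y)) ℕ.+ 1 ≡ ∑ᶠ (λ y → 𝟙 (InE? x y))
  offGraphCount-row f tf x = begin
    ∑ᶠ (λ y → 𝟙 (offGraph? f x y)) ℕ.+ 1
      ≡⟨ cong (∑ᶠ (λ y → 𝟙 (offGraph? f x y)) ℕ.+_) on-graph ⟨
    ∑ᶠ (λ y → 𝟙 (offGraph? f x y)) ℕ.+ ∑ᶠ (𝟙 ∘ graph?)
      ≡⟨ ∑ᶠ-+ (λ y → 𝟙 (offGraph? f x y)) (𝟙 ∘ graph?) ⟨
    ∑ᶠ (λ y → 𝟙 (offGraph? f x y) ℕ.+ 𝟙 (graph? y))
      ≡⟨ ∑ᶠ-cong (λ y → split (InE? x y) (graph? y)) ⟩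
    ∑ᶠ (λ y → 𝟙 (InE? x y)) ∎
    where
    open ≡-Reasoning
    graph? : ∀ y → Dec (y ≡ lookup f x)
    graph? y = y ≟ lookup f x
    on-graph : ∑ᶠ (𝟙 ∘ graph?) ≡ 1
    on-graph = trans (∑ᶠ-point _ (lookup f x) (λ y → 𝟙-no (graph? y))) (𝟙-yes (graph? (lookup f x)) refl)
    split : ∀ {y} (e? : Dec (InE x y)) (g? : Dec (y ≡ lookup f x)) → 𝟙 (e? ×-dec ¬? g?) ℕ.+ 𝟙 g? ≡ 𝟙 e?
    split (yes _) (yes _) = refl
    split (yes _) (no _) = refl
    split (no ¬e) (yes refl) = ⊥-elim (¬e (f , tf , refl))
    split (no _) (no _) = refl

  offGraphCount-InT : ∀ f g → InT f → InT g → offGraphCount f ≡ offGraphCount g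
  offGraphCount-InT f g tf tg =
    ∑ᶠ-cong (λ x → ℕ.+-cancelʳ-≡ 1 _ _ (trans (offGraphCount-row f tf x) (sym (offGraphCount-row g tg x))))

  E∖graph : Tableau → SubsetXY
  E∖graph f x = fromDec (offGraph? f x)

  ∣E∖graph∣ : ∀ f → ∣ E∖graph f ∣ₛ ≡ offGraphCount f
  ∣E∖graph∣ f = trans (∑-allFin (λ x → ∣ E∖graph f x ∣)) (∑ᶠ-cong (λ x → ∣tabulate∣ (does ∘ offGraph? f x)))

  E∖graph-face : ∀ f → InT f → IsFace (E∖graph f)
  E∖graph-face f tf = Equivalence.from (isFace⇔missed (E∖graph f) (λ x y → proj₁ ∘ ∈-fromDec⁻ (offGraph? f x)))
                                       (f , tf , λ x fx∈ → proj₂ (∈-fromDec⁻ (offGraph? f x) fx∈) refl)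

  face-bound : ∀ {G} → IsFace G → ∃ λ f → InT f × ∣ G ∣ₛ ≤ offGraphCount f
  face-bound {G} face@(_ , _ , _ , G≡E∖F) with Equivalence.to (isFace⇔missed G G⊆E) face
    where
    G⊆E : ∀ x y → y ∈ G x → InE x y
    G⊆E x y = proj₁ ∘ proj₁ (G≡E∖F x y)
  ... | f , tf , misses = f , tf , (begin
    ∣ G ∣ₛ                      ≡⟨ ∑-allFin (λ x → ∣ G x ∣) ⟩
    ∑ᶠ (λ x → ∣ G x ∣)          ≤⟨ ∑ᶠ-mono (λ x → p⊆q⇒∣p∣≤∣q∣ (G⊆E∖graph x)) ⟩
    ∑ᶠ (λ x → ∣ E∖graph f x ∣)  ≡⟨ ∑-allFin (λ x → ∣ E∖graph f x ∣) ⟨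
    ∣ E∖graph f ∣ₛ              ≡⟨ ∣E∖graph∣ f ⟩
    offGraphCount f             ∎)
    where
    open ℕ.≤-Reasoning
    G⊆E∖graph : ∀ x → G x ⊆ E∖graph f x
    G⊆E∖graph x {y} y∈G = ∈-fromDec⁺ (offGraph? f x) (proj₁ (proj₁ (G≡E∖F x y) y∈G) , λ { refl → misses x y∈G })

  krullDim≡offGraphCount : ∀ {d} → IsKrullDim d → ∀ f → InT f → d ≡ offGraphCount f
  krullDim≡offGraphCount {d} ((G , face , ∣G∣≡d) , maximal) f tf with face-bound face
  ... | f₀ , t₀ , ∣G∣≤ = ℕ.≤-antisym
    (subst (_≤ offGraphCount f) ∣G∣≡d (ℕ.≤-trans ∣G∣≤ (ℕ.≤-reflexive (offGraphCount-InT f₀ f t₀ tf))))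
    (subst (_≤ d) (∣E∖graph∣ f) (maximal (E∖graph f) (E∖graph-face f tf)))

  module _ (a : Exp n m) where

    Avoids : Tableau → Set
    Avoids f = ∀ x → a x (lookup f x) ≡ 0

    avoids? : Decidable₁ Avoids
    avoids? f = all? (λ x → a x (lookup f x) ℕ.≟ 0)

    avoidable? : Dec (∃ λ f → InT f × Avoids f)
    avoidable? = ∃T? avoids?

    ⊔-avoids : ∀ f g → Avoids f → Avoids g → Avoids (f ⊔ g)
    ⊔-avoids f g af ag x = ⊔-elim (λ y → a x y ≡ 0) f g x (af x) (ag x)

    RowGood : Tableau → Fin n → Set
    RowGood f x = a x (lookup f x) ≡ 0 × (∀ y → InU f x y → 1 ≤ a x y)

    rowGood? : ∀ f → Decidable₁ (RowGood f)
    rowGood? f x = a x (lookup f x) ℕ.≟ 0 ×-dec all? (λ y → InU? f x y →-dec 1 ℕ.≤? a x y)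

    Good : Tableau → Set
    Good f = ∀ x → RowGood f x

    good? : Decidable₁ Good
    good? f = all? (rowGood? f)

    module Greatest (f₀ : Tableau) (t₀ : InT f₀) (a₀ : Avoids f₀) where

      avoiders : List Tableau
      avoiders = filter avoids? Tlist

      avoiders-avoid : All (λ f → InT f × Avoids f) avoiders
      avoiders-avoid = All.tabulate λ f∈ → let f∈T , af = ∈-filter⁻ avoids? {xs = Tlist} f∈ in ∈Tlist⁻ f∈T , af

      f* : Tableau
      f* = foldr _⊔_ f₀ avoiders

      f*-avoiding : InT f* × Avoids f*
      f*-avoiding = foldr-preservesᵇ (λ {f} {g} (tf , af) (tg , ag) → ⊔-InT f g tf tg , ⊔-avoids f g af ag)
                                     (t₀ , a₀) avoiders-avoid

      f*-greatest : ∀ g → InT g → Avoids g → g ≤T f*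
      f*-greatest g tg ag = ⨆-upper t₀ (All.map proj₁ avoiders-avoid) (∈-filter⁺ avoids? (∈Tlist⁺ {g} tg) ag)

      f*-good : Good f*
      f*-good x = proj₂ f*-avoiding x , raised
        where
        raised : ∀ y → InU f* x y → 1 ≤ a x y
        raised y (f*x<y , t′) with 1 ℕ.≤? a x y
        ... | yes 1≤a = 1≤a
        ... | no 1≰a = ⊥-elim (<Y.<⇒≱ ≤Y.antisym f*x<y y≤f*x)
          where
          a′ : Avoids (f* [ x ]≔ y)
          a′ z with z ≟ x
          ... | yes refl rewrite lookup∘update x f* y = ℕ.n<1⇒n≡0 (ℕ.≰⇒> 1≰a)
          ... | no z≢x rewrite lookup∘update′ z≢x f* y = proj₂ f*-avoiding z
          y≤f*x : y ≤Y lookup f* x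
          y≤f*x = subst (_≤Y lookup f* x) (lookup∘update x f* y) (f*-greatest (f* [ x ]≔ y) t′ a′ x)

      -- If a good f differed from f*, raising f at a maximal point of
      -- disagreement to the value of f* would give an element of U_f(x) on
      -- which a vanishes.
      good⇒f* : ∀ {f} → InT f → Good f → f ≡ f*
      good⇒f* {f} tf good = trans (sym (tabulate∘lookup f)) (trans (tabulate-cong agree) (tabulate∘lookup f*))
        where
        f≤f* : f ≤T f*
        f≤f* = f*-greatest f tf (proj₁ ∘ good)
        Disagree : Fin n → Set
        Disagree z = lookup f z ≢ lookup f* z
        no-maximal-disagreement : (∃ λ x → Disagree x × (∀ {z} → z ∈ₗ allFin n → Disagree z → ¬ x <X z)) → ⊥
        no-maximal-disagreement (x , fx≢f*x , x-max) =
          ℕ.<⇒≢ (proj₂ (good x) (lookup f* x) ((f≤f* x , fx≢f*x) , raised)) (sym (proj₂ f*-avoiding x))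
          where
          above : ∀ z → x <X z → lookup f z ≡ lookup f* z
          above z x<z = decidable-stable (lookup f z ≟ lookup f* z) (λ fz≢f*z → x-max (∈-allFin z) fz≢f*z x<z)
          raised : InT (f [ x ]≔ lookup f* x)
          raised = raise-InT f f* x tf (proj₁ f*-avoiding) f≤f* above
        agree : ∀ x → lookup f x ≡ lookup f* x
        agree x = decidable-stable (lookup f x ≟ lookup f* x) λ fx≢f*x → no-maximal-disagreement
          (∃-maximal (<X.<-trans ≤X.isPartialOrder) (<X.<-irrefl refl) (<X.<-decidable _≟_ ≤X._≤?_)
                     (λ z → ¬? (lookup f z ≟ lookup f* z)) (allFin n) fx≢f*x)

    ∑-good : ∑[ f ∈ Tlist ] 𝟙 (good? f) ≡ 𝟙 avoidable?
    ∑-good = trans (∑-filter InT? (𝟙 ∘ good?) tableaux) (go avoidable?)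
      where
      tableaux : List Tableau
      tableaux = allVecs (allFin m) n
      good-in-T? : Decidable₁ (λ f → InT f × Good f)
      good-in-T? f = InT? f ×-dec good? f
      go : (d : Dec (∃ λ f → InT f × Avoids f)) → ∑[ f ∈ tableaux ] 𝟙 (InT? f) ℕ.* 𝟙 (good? f) ≡ 𝟙 d
      go (yes (f₀ , t₀ , a₀)) = begin
        ∑[ f ∈ tableaux ] 𝟙 (InT? f) ℕ.* 𝟙 (good? f)  ≡⟨ ∑-cong tableaux (λ f → 𝟙-× (InT? f) (good? f)) ⟩
        ∑[ f ∈ tableaux ] 𝟙 (good-in-T? f)            ≡⟨ ∑-allVecs-point n (𝟙 ∘ good-in-T?) f* off-f* ⟩
        𝟙 (good-in-T? f*)                            ≡⟨ 𝟙-yes (good-in-T? f*) (proj₁ f*-avoiding , f*-good) ⟩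
        1                                            ∎
        where
        open ≡-Reasoning
        open Greatest f₀ t₀ a₀
        off-f* : ∀ f → f ≢ f* → 𝟙 (good-in-T? f) ≡ 0
        off-f* f f≢f* = 𝟙-no (good-in-T? f) (λ (tf , gf) → f≢f* (good⇒f* tf gf))
      go (no unavoidable) = ∑-zero tableaux λ f →
        trans (𝟙-× (InT? f) (good? f)) (𝟙-no (good-in-T? f) (λ (tf , gf) → unavoidable (f , tf , proj₁ ∘ gf)))

    rowFactor : Tableau → Fin n → Poly n m
    rowFactor f x = pmul (psub pone (pvar x (lookup f x))) (pprod (map (pvar x) (Ulist f x)))

    seriesCoeff-rowFactor-good : ∀ f x → seriesCoeff (rowFactor f x) a ≡ + 𝟙 (rowGood? f x)
    seriesCoeff-rowFactor-good f x = begin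
      seriesCoeff (rowFactor f x) a
        ≡⟨ seriesCoeff-rowFactor a x (lookup f x) U U-unique U-≢fx ⟩
      + (𝟙 (avoided?) ℕ.* 𝟙 (All.all? ≥1? U))
        ≡⟨ cong +_ (𝟙-× avoided? (All.all? ≥1? U)) ⟩
      + 𝟙 (avoided? ×-dec All.all? ≥1? U)
        ≡⟨ cong +_ (𝟙-⇔ row⇔ (avoided? ×-dec All.all? ≥1? U) (rowGood? f x)) ⟩
      + 𝟙 (rowGood? f x) ∎
      where
      open ≡-Reasoning
      U : List (Fin m)
      U = Ulist f x
      avoided? : Dec (a x (lookup f x) ≡ 0)
      avoided? = a x (lookup f x) ℕ.≟ 0
      ≥1? : Decidable₁ (λ y → 1 ≤ a x y)
      ≥1? y = 1 ℕ.≤? a x y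
      U-unique : Unique U
      U-unique = Unique.filter⁺ (InU? f x) (Unique.allFin⁺ m)
      U-≢fx : All (_≢ lookup f x) U
      U-≢fx = All.map (λ (fx<y , _) y≡fx → proj₂ fx<y (sym y≡fx)) (all-filter (InU? f x) (allFin m))
      row⇔ : (a x (lookup f x) ≡ 0 × All (λ y → 1 ≤ a x y) U) ⇔ RowGood f x
      row⇔ = ⇔-refl ×-⇔ All-filter-allFin⇔ (InU? f x)

    seriesCoeff-term : ∀ f → seriesCoeff (pprod (map (rowFactor f) (allFin n))) a ≡ + 𝟙 (good? f)
    seriesCoeff-term f = begin
      seriesCoeff (pprod (map (rowFactor f) (allFin n))) a
        ≡⟨ seriesCoeff-pprod a row (rowFactor f) rows (allFin n) rows# ⟩
      ∏ℤ (map (λ x → seriesCoeff (rowFactor f x) a) (allFin n))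
        ≡⟨ cong ∏ℤ (map-cong (seriesCoeff-rowFactor-good f) (allFin n)) ⟩
      ∏ℤ (map (λ x → + 𝟙 (rowGood? f x)) (allFin n))
        ≡⟨ ∏ℤ-+ (𝟙 ∘ rowGood? f) (allFin n) ⟩
      + product (map (𝟙 ∘ rowGood? f) (allFin n))
        ≡⟨ cong +_ (product-𝟙 (rowGood? f) (allFin n)) ⟩
      + 𝟙 (All.all? (rowGood? f) (allFin n))
        ≡⟨ cong +_ (𝟙-⇔ (mk⇔ tabulate⁻ tabulate⁺) (All.all? (rowGood? f) (allFin n)) (good? f)) ⟩
      + 𝟙 (good? f) ∎
      where
      open ≡-Reasoning
      rows : ∀ x → AllExps (VanishesOff (row x)) (rowFactor f x)
      rows x = rowFactor-vanishesOff x (lookup f x) (Ulist f x)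
      rows# : AllPairs (λ x x′ → Disjoint (row x) (row x′)) (allFin n)
      rows# = AllPairs.map row-disjoint (Unique.allFin⁺ n)

    seriesCoeff-Kformula : seriesCoeff Kformula a ≡ + 𝟙 avoidable?
    seriesCoeff-Kformula = begin
      seriesCoeff Kformula a                           ≡⟨ seriesCoeff-psum a term Tlist ⟩
      sumℤ (map (λ f → seriesCoeff (term f) a) Tlist)  ≡⟨ cong sumℤ (map-cong seriesCoeff-term Tlist) ⟩
      sumℤ (map (λ f → + 𝟙 (good? f)) Tlist)           ≡⟨ sumℤ-+ (𝟙 ∘ good?) Tlist ⟩
      + (∑[ f ∈ Tlist ] 𝟙 (good? f))                   ≡⟨ cong +_ ∑-good ⟩
      + 𝟙 avoidable?                                   ∎
      where
      open ≡-Reasoning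
      term : Tableau → Poly n m
      term f = pprod (map (rowFactor f) (allFin n))

    supported? : Dec (SupportedOnE a)
    supported? = all? (λ x → all? (λ y → ¬? (InE? x y) →-dec a x y ℕ.≟ 0))

    InI⇔unavoidable : SupportedOnE a → InI a ⇔ (¬ ∃ λ f → InT f × Avoids f)
    InI⇔unavoidable supported = mk⇔ InI⇒unavoidable unavoidable⇒InI
      where
      InI⇒unavoidable : InI a → ¬ ∃ λ f → InT f × Avoids f
      InI⇒unavoidable (G , G⊆E , ¬face , a≥1) (f , tf , af) =
        ¬face (Equivalence.from (isFace⇔missed G G⊆E) (f , tf , λ x fx∈G → ℕ.<⇒≢ (a≥1 x _ fx∈G) (sym (af x))))
      unavoidable⇒InI : (¬ ∃ λ f → InT f × Avoids f) → InI a
      unavoidable⇒InI unavoidable = supp , supp⊆E , ¬face , λ x y → ∈-fromDec⁻ (positive? x)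
        where
        positive? : ∀ x → Decidable₁ (λ y → 1 ≤ a x y)
        positive? x y = 1 ℕ.≤? a x y
        supp : SubsetXY
        supp x = fromDec (positive? x)
        supp⊆E : ∀ x y → y ∈ supp x → InE x y
        supp⊆E x y y∈supp = decidable-stable (InE? x y)
          (λ y∉E → ℕ.<⇒≢ (∈-fromDec⁻ (positive? x) y∈supp) (sym (supported x y y∉E)))
        ¬face : ¬ IsFace supp
        ¬face face with Equivalence.to (isFace⇔missed supp supp⊆E) face
        ... | f , tf , misses =
          unavoidable (f , tf , λ x → ℕ.n<1⇒n≡0 (ℕ.≰⇒> (misses x ∘ ∈-fromDec⁺ (positive? x))))

    hilbert≡ : ∀ H → IsHilbertFunction H → H a ≡ 𝟙 supported? ℕ.* 𝟙 avoidable?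
    hilbert≡ H isH = go supported? avoidable?
      where
      go : (s : Dec (SupportedOnE a)) (v : Dec (∃ λ f → InT f × Avoids f)) → H a ≡ 𝟙 s ℕ.* 𝟙 v
      go (no unsupported) _ = proj₁ (isH a) unsupported
      go (yes supported) (yes avoidable) =
        proj₂ (proj₂ (isH a)) supported (λ i → Equivalence.to (InI⇔unavoidable supported) i avoidable)
      go (yes supported) (no unavoidable) =
        proj₁ (proj₂ (isH a)) supported (Equivalence.from (InI⇔unavoidable supported) unavoidable)

    hilbert-supported : ∀ H → IsHilbertFunction H → SupportedOnE a → H a ≡ 𝟙 avoidable?
    hilbert-supported H isH supported = begin
      H a                                   ≡⟨ hilbert≡ H isH ⟩
      𝟙 supported? ℕ.* 𝟙 avoidable?         ≡⟨ cong (ℕ._* 𝟙 avoidable?) (𝟙-yes supported? supported) ⟩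
      1 ℕ.* 𝟙 avoidable?                    ≡⟨ ℕ.*-identityˡ _ ⟩
      𝟙 avoidable?                          ∎
      where open ≡-Reasoning

    Fits : Tableau → Set
    Fits f = ∀ x y → Allowed (cellType f x y) (a x y)

    fits⇔ : ∀ f → Fits f ⇔ (SupportedOnE a × Good f)
    fits⇔ f = mk⇔
      (λ fits → (λ x y → proj₁ (conditions fits x y)) ,
                (λ x → proj₁ (proj₂ (conditions fits x (lookup f x))) refl ,
                       λ y → proj₂ (proj₂ (conditions fits x y))))
      (λ (supported , good) x y → Equivalence.from (allowed⇔conditions x y)
                                    (supported x y , (λ { refl → proj₁ (good x) }) , proj₂ (good x) y))
      where
      Conditions : Fin n → Fin m → Set
      Conditions x y = (¬ InE x y → a x y ≡ 0) × (y ≡ lookup f x → a x y ≡ 0) × (InU f x y → 1 ≤ a x y)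
      allowed⇔conditions : ∀ x y → Allowed (cellType f x y) (a x y) ⇔ Conditions x y
      allowed⇔conditions x y = classify-allowed⇔ {f} (InU? f x y) (offGraph? f x y)
      conditions : Fits f → ∀ x y → Conditions x y
      conditions fits x y = Equivalence.to (allowed⇔conditions x y) (fits x y)

    weight : Tableau → ℕ
    weight f = ∏ᶠ (λ x → ∏ᶠ (λ y → 𝟙 (allowed? (cellType f x y) (a x y))))

    weight≡ : ∀ f → weight f ≡ 𝟙 supported? ℕ.* 𝟙 (good? f)
    weight≡ f = begin
      ∏ᶠ (λ x → ∏ᶠ (λ y → 𝟙 (allowed? (cellType f x y) (a x y))))
        ≡⟨ ∏ᶠ-cong (λ x → ∏ᶠ-𝟙 (row-allowed? x)) ⟩
      ∏ᶠ (λ x → 𝟙 (all? (row-allowed? x)))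
        ≡⟨ ∏ᶠ-𝟙 (all? ∘ row-allowed?) ⟩
      𝟙 (all? (all? ∘ row-allowed?))
        ≡⟨ 𝟙-⇔ (fits⇔ f) (all? (all? ∘ row-allowed?)) (supported? ×-dec good? f) ⟩
      𝟙 (supported? ×-dec good? f)
        ≡⟨ 𝟙-× supported? (good? f) ⟨
      𝟙 supported? ℕ.* 𝟙 (good? f) ∎
      where
      open ≡-Reasoning
      row-allowed? : ∀ x → Decidable₁ (λ y → Allowed (cellType f x y) (a x y))
      row-allowed? x y = allowed? (cellType f x y) (a x y)

    hilbert≡∑weight : ∀ H → IsHilbertFunction H → H a ≡ ∑[ f ∈ Tlist ] weight f
    hilbert≡∑weight H isH = begin
      H a                                            ≡⟨ hilbert≡ H isH ⟩
      𝟙 supported? ℕ.* 𝟙 avoidable?                  ≡⟨ cong (𝟙 supported? ℕ.*_) ∑-good ⟨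
      𝟙 supported? ℕ.* (∑[ f ∈ Tlist ] 𝟙 (good? f))  ≡⟨ ∑-*ˡ (𝟙 supported?) (𝟙 ∘ good?) Tlist ⟨
      ∑[ f ∈ Tlist ] 𝟙 supported? ℕ.* 𝟙 (good? f)    ≡⟨ ∑-cong Tlist (sym ∘ weight≡) ⟩
      ∑[ f ∈ Tlist ] weight f                        ∎
      where open ≡-Reasoning

  Usize : Tableau → ℕ
  Usize f = sumℕ (map (∣U∣ f) (allFin n))

  ∑varCount≡offGraphCount : ∀ f → ∑ᶠ (λ x → ∑ᶠ (λ y → varCount (cellType f x y))) ≡ offGraphCount f
  ∑varCount≡offGraphCount f = ∑ᶠ-cong (λ x → ∑ᶠ-cong (λ y → classify-varCount {f} (InU? f x y) (offGraph? f x y)))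

  ∑reqCount≡Usize : ∀ f → ∑ᶠ (λ x → ∑ᶠ (λ y → reqCount (cellType f x y))) ≡ Usize f
  ∑reqCount≡Usize f = trans (∑ᶠ-cong row-sum) (sym (∑-allFin (∣U∣ f)))
    where
    row-sum : ∀ x → ∑ᶠ (λ y → reqCount (cellType f x y)) ≡ ∣U∣ f x
    row-sum x = begin
      ∑ᶠ (λ y → reqCount (cellType f x y))
        ≡⟨ ∑ᶠ-cong (λ y → classify-reqCount {f} (InU? f x y) (offGraph? f x y)) ⟩
      ∑ᶠ (λ y → 𝟙 (InU? f x y))
        ≡⟨ ∑-allFin (λ y → 𝟙 (InU? f x y)) ⟨
      ∑[ y ∈ allFin m ] 𝟙 (InU? f x y)
        ≡⟨ length-filter (InU? f x) (allFin m) ⟨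
      ∣U∣ f x ∎
      where open ≡-Reasoning

  ∑-weight : ∀ {d} → IsKrullDim d → ∀ f → InT f → ∀ N →
             ∑[ a ∈ expsOfDegree N ] weight a f ≡ divisibleMonomials d (Usize f) N
  ∑-weight krull f tf N = trans (∑-expsOfDegree (cellType f) N)
    (cong₂ (λ D R → divisibleMonomials D R N)
           (trans (∑varCount≡offGraphCount f) (sym (krullDim≡offGraphCount krull f tf)))
           (∑reqCount≡Usize f))

  ∑-countT : ∀ d N → ∑[ j ∈ upTo (ℕ.suc N) ] countT j ℕ.* monomials d (N ℕ.∸ j)
                     ≡ ∑[ f ∈ Tlist ] divisibleMonomials d (Usize f) N
  ∑-countT d N = begin
    ∑[ j ∈ js ] countT j ℕ.* M j
      ≡⟨ ∑-cong js count-as-sum ⟩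
    ∑[ j ∈ js ] ∑[ f ∈ Tlist ] 𝟙 (Usize f ℕ.≟ j) ℕ.* M j
      ≡⟨ ∑-comm (λ j f → 𝟙 (Usize f ℕ.≟ j) ℕ.* M j) js Tlist ⟩
    ∑[ f ∈ Tlist ] ∑[ j ∈ js ] 𝟙 (Usize f ℕ.≟ j) ℕ.* M j
      ≡⟨ ∑-cong Tlist at-Usize ⟩
    ∑[ f ∈ Tlist ] divisibleMonomials d (Usize f) N ∎
    where
    open ≡-Reasoning
    js : List ℕ
    js = upTo (ℕ.suc N)
    M : ℕ → ℕ
    M j = monomials d (N ℕ.∸ j)
    count-as-sum : ∀ j → countT j ℕ.* M j ≡ ∑[ f ∈ Tlist ] 𝟙 (Usize f ℕ.≟ j) ℕ.* M j
    count-as-sum j = begin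
      countT j ℕ.* M j
        ≡⟨ cong (ℕ._* M j) (length-filter (λ f → Usize f ℕ.≟ j) Tlist) ⟩
      (∑[ f ∈ Tlist ] 𝟙 (Usize f ℕ.≟ j)) ℕ.* M j
        ≡⟨ ℕ.*-comm _ (M j) ⟩
      M j ℕ.* (∑[ f ∈ Tlist ] 𝟙 (Usize f ℕ.≟ j))
        ≡⟨ ∑-*ˡ (M j) (λ f → 𝟙 (Usize f ℕ.≟ j)) Tlist ⟨
      ∑[ f ∈ Tlist ] M j ℕ.* 𝟙 (Usize f ℕ.≟ j)
        ≡⟨ ∑-cong Tlist (λ f → ℕ.*-comm (M j) _) ⟩
      ∑[ f ∈ Tlist ] 𝟙 (Usize f ℕ.≟ j) ℕ.* M j ∎
    at-Usize : ∀ f → ∑[ j ∈ js ] 𝟙 (Usize f ℕ.≟ j) ℕ.* M j ≡ divisibleMonomials d (Usize f) N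
    at-Usize f = begin
      ∑[ j ∈ js ] 𝟙 (Usize f ℕ.≟ j) ℕ.* M j
        ≡⟨ ∑-upTo-point N _ (Usize f) off-Usize ⟩
      (if does (Usize f ℕ.≤? N) then 𝟙 (Usize f ℕ.≟ Usize f) ℕ.* M (Usize f) else 0)
        ≡⟨ cong (λ v → if does (Usize f ℕ.≤? N) then v else 0) at ⟩
      divisibleMonomials d (Usize f) N ∎
      where
      off-Usize : ∀ j → j ≢ Usize f → 𝟙 (Usize f ℕ.≟ j) ℕ.* M j ≡ 0
      off-Usize j j≢ = cong (ℕ._* M j) (𝟙-no (Usize f ℕ.≟ j) (j≢ ∘ sym))
      at : 𝟙 (Usize f ℕ.≟ Usize f) ℕ.* M (Usize f) ≡ monomialCount d (N ℕ.∸ Usize f)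
      at = begin
        𝟙 (Usize f ℕ.≟ Usize f) ℕ.* M (Usize f)
          ≡⟨ cong (ℕ._* M (Usize f)) (𝟙-yes (Usize f ℕ.≟ Usize f) refl) ⟩
        1 ℕ.* M (Usize f)
          ≡⟨ ℕ.*-identityˡ _ ⟩
        monomials d (N ℕ.∸ Usize f)
          ≡⟨ monomialCount≡C d (N ℕ.∸ Usize f) ⟨
        monomialCount d (N ℕ.∸ Usize f) ∎

open FiniteSums
open MonomialCounting

theorem4p5 : (D : TableauData) → Tableaux.Theorem4p5 D
theorem4p5 D H isH = K-polynomial , h-vector
  where
  open TableauData D
  open Tableaux D
  open TableauTheory D
  K-polynomial : ∀ a → SupportedOnE a → ℤ.+ H a ≡ seriesCoeff Kformula a
  K-polynomial a supported =
    trans (cong ℤ.+_ (hilbert-supported a H isH supported)) (sym (seriesCoeff-Kformula a))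
  h-vector : ∀ d → IsKrullDim d → IsHVector H d countT
  h-vector d krull N = begin
    ∑[ a ∈ expsOfDegree N ] H a
      ≡⟨ ∑-cong (expsOfDegree N) (λ a → hilbert≡∑weight a H isH) ⟩
    ∑[ a ∈ expsOfDegree N ] ∑[ f ∈ Tlist ] weight a f
      ≡⟨ ∑-comm (λ a f → weight a f) (expsOfDegree N) Tlist ⟩
    ∑[ f ∈ Tlist ] ∑[ a ∈ expsOfDegree N ] weight a f
      ≡⟨ ∑-cong-∈ Tlist (λ {f} f∈T → ∑-weight krull f (∈Tlist⁻ f∈T) N) ⟩
    ∑[ f ∈ Tlist ] divisibleMonomials d (Usize f) N
      ≡⟨ ∑-countT d N ⟨
    ∑[ j ∈ upTo (ℕ.suc N) ] countT j ℕ.* monomials d (N ℕ.∸ j) ∎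
    where open ≡-Reasoning
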